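{- Let $G$ be a tessellation of the sphere $\mathbb{S}^2$ with $\mathrm{Ric}_F(e)>0$ for every edge $e$, let $G'$ be its medial graph and $(G')^*$ the dual graph of $G'$. Then $(G')^*\in\mathcal{Q}$, where $\mathcal{Q}$ is the set of $2$-connected, simple spherical quadrangulations $H=(V_H,E_H,F_H)$ with $\#F_H\le 24$ all of whose face patterns lie in the list $$(3,3,3,3),\ (3,3,3,4),\ (3,3,3,5),\ (3,3,3,6),\ (3,3,4,4),\ (3,3,4,5),\ (3,4,4,4).$$
   Context: A graph on a surface: a locally finite simple undirected graph embedded in a surface, faces being the components of the complement; vertex degrees $|x|$ and face degrees $|\sigma|$ (number of incident edges) are at least $3$. $G$ is a tessellation if: (i) every compact subset of the surface is covered by finitely many closed faces; (ii) each closed face is a closed disk bounded by finitely many edges; (iii) each edge lies in exactly two different closed faces; (iv) two intersecting closed faces meet in a vertex or in the closure of an edge. Two distinct edges are parallel neighbors if exactly one holds: they share an endpoint, or they lie on a common face; $\mathrm{Ric}_F(e)=\#\{\text{faces containing } e\}+\#\{\text{endpoints of } e\}-\#\{\text{parallel neighbors of } e\}$. Medial graph $G'$: vertices are interior points $M_e$ of the edges $e$; $M_{e_1},M_{e_2}$ are joined by a curve inside face $f$ whenever $e_1,e_2$ share an endpoint and both lie on $f$, curves non-crossing. Dual graph $H^*$ of a planar graph $H$: vertices correspond to faces of $H$, faces to vertices of $H$, and two vertices are adjacent iff the corresponding faces share an edge. A spherical quadrangulation is a graph on $\mathbb{S}^2$ all of whose faces have degree $4$; the face pattern of a face is $(|v_1|,|v_2|,|v_3|,|v_4|)$,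 the degrees of its four vertices sorted increasingly. A graph is $2$-connected if it cannot be disconnected by removing one vertex. -}

module Defs where

open import Data.Nat using (ℕ; zero; suc; _+_; _≤_; _<ᵇ_; _≤ᵇ_)
open import Data.Nat.Properties using (≤-decTotalOrder)
open import Data.Integer as ℤ using (ℤ; +_)
open import Data.Fin using (Fin; toℕ; _≟_; _↑ˡ_; _↑ʳ_; splitAt)
open import Data.Bool using (Bool; true; false; if_then_else_; _∧_; _∨_; _xor_; not)
open import Data.List using (List; []; _∷_; length; filterᵇ; allFin; upTo; map)
open import Data.Bool.ListAction using (any; all)
open import Data.Sum using (_⊎_; inj₁; inj₂; [_,_])
open import Data.Product using (∃-syntax; _×_; _,_)
open import Data.Empty using (⊥)
open import Relation.Nullary using (¬_; does)
open import Relation.Binary.PropositionalEquality using (_≡_; _≢_)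
open import Data.List.Membership.Propositional using (_∈_)
open import Data.List.Sort.InsertionSort.Base ≤-decTotalOrder using (sort)

-- Darts are Fin n.  σ rotates darts counter-clockwise around their
-- initial vertex (σ⁻ is its inverse), α reverses a dart (the two darts
-- of an edge).  Vertices = σ-orbits, edges = α-orbits,
-- faces = φ-orbits where φ = σ ∘ α.

record Map : Set where
  field
    n  : ℕ
    σ  : Fin n → Fin n
    σ⁻ : Fin n → Fin n
    α  : Fin n → Fin n

  Dart : Set
  Dart = Fin n

  φ : Dart → Dart
  φ d = σ (α d)

  iter : (Dart → Dart) → ℕ → Dart → Dart
  iter f zero    d = d
  iter f (suc k) d = f (iter f k d)

  Orb : (Dart → Dart) → Dart → Dart → Set
  Orb f a b = ∃[ k ] iter f k a ≡ b

  -- boolean version (periods of permutations of Fin n are ≤ n)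
  orbᵇ : (Dart → Dart) → Dart → Dart → Bool
  orbᵇ f a b = any (λ k → does (iter f k a ≟ b)) (upTo n)

  orbSize : (Dart → Dart) → Dart → ℕ
  orbSize f d = length (filterᵇ (orbᵇ f d) (allFin n))

  -- number of f-orbits (counted by their minimal elements)
  #orbits : (Dart → Dart) → ℕ
  #orbits f = length (filterᵇ (λ d → all (λ k → toℕ d ≤ᵇ toℕ (iter f k d)) (upTo n)) (allFin n))

  #V #E #F : ℕ
  #V = #orbits σ
  #E = #orbits α
  #F = #orbits φ

  SameVertex SameEdge SameFace : Dart → Dart → Set
  SameVertex = Orb σ
  SameEdge   = Orb α
  SameFace   = Orb φ

  vdeg fdeg : Dart → ℕ
  vdeg = orbSize σ
  fdeg = orbSize φ

  record IsMap : Set where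
    field
      σσ⁻ : ∀ d → σ (σ⁻ d) ≡ d
      σ⁻σ : ∀ d → σ⁻ (σ d) ≡ d
      αα  : ∀ d → α (α d) ≡ d
      α-fpf : ∀ d → α d ≢ d

  data Reach : Dart → Dart → Set where
    here   : ∀ {d} → Reach d d
    σ-step : ∀ {d d'} → Reach (σ d) d' → Reach d d'
    α-step : ∀ {d d'} → Reach (α d) d' → Reach d d'

  Connected : Set
  Connected = ∀ d d' → Reach d d'

  Spherical : Set
  Spherical = Connected × (#V + #F ≡ #E + 2)

  -- underlying graph is simple: no loops, no multiple edges
  Simple : Set
  Simple = (∀ d → ¬ SameVertex d (α d))
         × (∀ d d' → SameVertex d d' → SameVertex (α d) (α d') → d ≡ d')

  data ReachAvoid (v : Dart) : Dart → Dart → Set where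
    here   : ∀ {d} → ReachAvoid v d d
    σ-step : ∀ {d d'} → ¬ SameVertex v (σ d) → ReachAvoid v (σ d) d' → ReachAvoid v d d'
    α-step : ∀ {d d'} → ¬ SameVertex v (α d) → ReachAvoid v (α d) d' → ReachAvoid v d d'

  TwoConnected : Set
  TwoConnected = ∀ v a b → ¬ SameVertex v a → ¬ SameVertex v b → ReachAvoid v a b

  VertexOnFace : Dart → Dart → Set
  VertexOnFace u f = ∃[ x ] (SameFace f x × SameVertex u x)

  EdgeOnFace : Dart → Dart → Set
  EdgeOnFace e f = SameFace f e ⊎ SameFace f (α e)

  -- Tessellation of the sphere (conditions (i)-(iv) of the paper,
  -- together with simplicity and degree ≥ 3)
  record Tessellation : Set where
    field
      isMap      : IsMap
      spherical  : Spherical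
      simple     : Simple
      vdeg≥3     : ∀ d → 3 ≤ vdeg d
      fdeg≥3     : ∀ d → 3 ≤ fdeg d
      -- (ii) closed faces are closed disks: the boundary walk of every
      --      face is a simple cycle (no vertex repeated)
      face-disk  : ∀ x y → SameFace x y → x ≢ y → ¬ SameVertex x y
      two-faces  : ∀ d → ¬ SameFace d (α d)
      -- (iv) two distinct closed faces meet in ∅, a vertex, or a closed edge:
      --      two distinct common vertices are the endpoints of a common edge,
      --      and there are no three pairwise distinct common vertices
      meet-edge  : ∀ f g → ¬ SameFace f g → ∀ u w →
                   VertexOnFace u f → VertexOnFace u g →
                   VertexOnFace w f → VertexOnFace w g → ¬ SameVertex u w →
                   ∃[ e ] (EdgeOnFace e f × EdgeOnFace e g ×
                           ((SameVertex u e × SameVertex w (α e)) ⊎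
                            (SameVertex w e × SameVertex u (α e))))
      meet-≤2    : ∀ f g → ¬ SameFace f g → ∀ u w t →
                   VertexOnFace u f → VertexOnFace u g →
                   VertexOnFace w f → VertexOnFace w g →
                   VertexOnFace t f → VertexOnFace t g →
                   ¬ SameVertex u w → ¬ SameVertex u t → ¬ SameVertex w t → ⊥

  -- Combinatorial curvature Ric_F of the edge of dart d
  -- (edges e' are counted via their representative dart d' with d' < α d')

  sharesEndpointᵇ : Dart → Dart → Bool
  sharesEndpointᵇ d d' = orbᵇ σ d d' ∨ orbᵇ σ d (α d') ∨ orbᵇ σ (α d) d' ∨ orbᵇ σ (α d) (α d')

  sharesFaceᵇ : Dart → Dart → Bool
  sharesFaceᵇ d d' = orbᵇ φ d d' ∨ orbᵇ φ d (α d') ∨ orbᵇ φ (α d) d' ∨ orbᵇ φ (α d) (α d')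

  isParallelNeighbourᵇ : Dart → Dart → Bool
  isParallelNeighbourᵇ d d' =
    (toℕ d' <ᵇ toℕ (α d')) ∧ not (does (d' ≟ d)) ∧ not (does (d' ≟ α d))
    ∧ (sharesEndpointᵇ d d' xor sharesFaceᵇ d d')

  #parallel : Dart → ℕ
  #parallel d = length (filterᵇ (isParallelNeighbourᵇ d) (allFin n))

  #facesOf #endpointsOf : Dart → ℕ
  #facesOf d     = if orbᵇ φ d (α d) then 1 else 2
  #endpointsOf d = if orbᵇ σ d (α d) then 1 else 2

  RicF : Dart → ℤ
  RicF d = + (#facesOf d + #endpointsOf d) ℤ.- + #parallel d

  facePattern : Dart → List ℕ
  facePattern d = sort (map vdeg (d ∷ φ d ∷ φ (φ d) ∷ φ (φ (φ d)) ∷ []))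

  allowedPatterns : List (List ℕ)
  allowedPatterns =
      (3 ∷ 3 ∷ 3 ∷ 3 ∷ []) ∷ (3 ∷ 3 ∷ 3 ∷ 4 ∷ []) ∷ (3 ∷ 3 ∷ 3 ∷ 5 ∷ []) ∷
      (3 ∷ 3 ∷ 3 ∷ 6 ∷ []) ∷ (3 ∷ 3 ∷ 4 ∷ 4 ∷ []) ∷ (3 ∷ 3 ∷ 4 ∷ 5 ∷ []) ∷
      (3 ∷ 4 ∷ 4 ∷ 4 ∷ []) ∷ []

  record InQ : Set where
    field
      isMap        : IsMap
      spherical    : Spherical
      simple       : Simple
      twoConnected : TwoConnected
      quadrangular : ∀ d → fdeg d ≡ 4
      #F≤24        : #F ≤ 24
      patterns     : ∀ d → facePattern d ∈ allowedPatterns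

open Map public

-- Dual map: same darts, vertex rotation φ = σ ∘ α (inverse α ∘ σ⁻).
-- Vertices of the dual = faces of M, faces of the dual = vertices of M.

dual : Map → Map
dual M = record { n = n M ; σ = λ d → σ M (α M d) ; σ⁻ = λ d → α M (σ⁻ M d) ; α = α M }

-- For every corner (x , σ x) of M there is one medial edge,
-- drawn inside the face of that corner, joining the midpoints M_{e(x)}
-- and M_{e(σ x)}.  Its two darts are
--   x ↑ˡ n  ("(x,0)", starting at M_{e(x)})  and
--   n ↑ʳ x  ("(x,1)", starting at M_{e(σ x)}).
-- Counter-clockwise around M_e, e = {d , α d}, the four medial darts are
--   (σ⁻(α d),1) → (d,0) → (σ⁻ d,1) → (α d,0) → (σ⁻(α d),1).

medial : Map → Map
medial M = record { n = n M + n M ; σ = σM ; σ⁻ = σM⁻ ; α = αM }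
  where
  m = n M
  αM : Fin (m + m) → Fin (m + m)
  αM i = [ (λ x → m ↑ʳ x) , (λ x → x ↑ˡ m) ] (splitAt m i)
  σM : Fin (m + m) → Fin (m + m)
  σM i = [ (λ x → m ↑ʳ σ⁻ M x) , (λ y → α M (σ M y) ↑ˡ m) ] (splitAt m i)
  σM⁻ : Fin (m + m) → Fin (m + m)
  σM⁻ i = [ (λ x → m ↑ʳ σ⁻ M (α M x)) , (λ y → σ M y ↑ˡ m) ] (splitAt m i)

-- Let e = {d, α d} have end vertices x, y and side faces f, g. In a tessellation the edges σⁱ d
-- (2 ≤ i ≤ |x| − 2), the analogous edges at y, the edges φʲ d (2 ≤ j ≤ |f| − 2) and those along g
-- are |x| + |y| + |f| + |g| − 12 pairwise distinct parallel neighbours of e: the disk condition,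
-- simplicity and the meeting condition (iv) keep them apart. As e lies on two faces and has two
-- endpoints, Ric_F(e) = 4 − #parallel(e) > 0 gives |x| + |y| + |f| + |g| ≤ 15. Summed over the darts
-- this reads ∑_v |v|² + ∑_f |f|² ≤ 15 E, and k² ≥ 7k − 12 together with Euler's formula turns it
-- into 28 E − 12 (E + 2) ≤ 15 E, that is E ≤ 24.
--
-- The dual of the medial map has a vertex for every vertex and every face of G and a quadrangle for
-- every edge e, with corner degrees |x|, |f|, |y|, |g|. So it has E ≤ 24 faces, each face pattern is
-- a sorted quadruple of numbers ≥ 3 with sum ≤ 15 (these are exactly the seven listed ones), and
-- (V + F) − 2E + E = 2. It is simple because G is simple and its faces are disks, and 2-connected
-- because the neighbours of each of its vertices can be joined by a walk avoiding that vertex.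

module Submission where

open import Defs

-- the imports stay local, so that _<_ in the statement of lemma3p2 is the one on ℤ
module _ where
  open import Data.Bool using (Bool; true; false; T; _∧_; _∨_; _xor_; not; if_then_else_)
  open import Data.Bool.ListAction using (all)
  open import Data.Bool.Properties using (T-∧; T-∨; T?)
  open import Data.Empty using (⊥-elim)
  open import Data.Fin using (Fin; zero; suc; toℕ; _↑ˡ_; _↑ʳ_; splitAt) renaming (_≟_ to _≟ᶠ_)
  import Data.Fin.Permutation as Perm
  import Data.Fin.Properties as Finₚ
  open import Data.Integer as ℤ using (0ℤ)
  import Data.Integer.Properties as ℤₚ
  open import Data.List using (List; []; _∷_; _++_; length; map; filterᵇ; allFin; tabulate; upTo; applyUpTo)
  open import Data.List.Membership.Propositional using (_∈_)
  open import Data.List.Membership.Propositional.Properties using (∈-applyUpTo⁺; ∈-applyUpTo⁻; ∈-upTo⁺)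
  open import Data.List.Properties using (length-applyUpTo; length-map; length-++; ≡-dec)
  open import Data.List.Relation.Unary.All as All using (All)
  import Data.List.Relation.Unary.All.Properties as Allₚ
  open import Data.List.Relation.Unary.AllPairs as AllPairs using (AllPairs; []; _∷_)
  import Data.List.Relation.Unary.AllPairs.Properties as AllPairsₚ
  import Data.List.Relation.Unary.Any as Any
  import Data.List.Relation.Unary.Any.Properties as Anyₚ
  open import Data.List.Relation.Unary.Unique.Propositional using (Unique)
  open import Data.Nat
  open import Data.Nat.DivMod using (_%_; _/_; m≡m%n+[m/n]*n; m%n<n; m/n*n≡m)
  open import Data.Nat.Divisibility using (_∣_; ∣-trans; m∣m*n; m≤n⇒m!∣n!)
  open import Data.Nat.Properties
  open import Data.Nat.Tactic.RingSolver using (solve-∀)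
  open import Data.Product as Product using (∃-syntax; _×_; _,_; proj₁; proj₂; uncurry)
  open import Data.Sum as Sum using (_⊎_; inj₁; inj₂; [_,_])
  open import Function using (_∘_; id; _⇔_; Equivalence; mk⇔)
  open import Relation.Binary.Definitions using (tri<; tri≈; tri>)
  open import Relation.Binary.PropositionalEquality hiding ([_])
  open import Relation.Nullary using (¬_; Dec; yes; no; does; _because_; contradiction)
  open import Relation.Nullary.Decidable using (map′; toWitness; _→-dec_)
  open import Relation.Nullary.Reflects using (invert)
  open import Relation.Unary using (Decidable)

  open import Algebra.Properties.Semiring.Sum +-*-semiring
    using (sum; sum-cong-≗; ∑-distrib-+; ∑-comm; ∑-permute; *-distribˡ-sum; *-distribʳ-sum)
  open import Data.List.Extrema ≤-totalOrder using (argmin; argmin-all; f[argmin]≤f[xs])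
  open import Data.List.Membership.DecPropositional (≡-dec _≟_) using () renaming (_∈?_ to _∈ᴸ?_)
  open import Data.List.Sort.InsertionSort.Base ≤-decTotalOrder using (sort)

  T-does⇔ : ∀ {A : Set} (a? : Dec A) → T (does a?) ⇔ A
  T-does⇔ (true  because [a])  = mk⇔ (λ _ → invert [a]) _
  T-does⇔ (false because [¬a]) = mk⇔ (λ ()) (invert [¬a])

  T-∨⇔⊎ : ∀ {a b} {A B : Set} → T a ⇔ A → T b ⇔ B → T (a ∨ b) ⇔ (A ⊎ B)
  T-∨⇔⊎ a⇔A b⇔B = mk⇔ (Sum.map (Equivalence.to a⇔A) (Equivalence.to b⇔B) ∘ Equivalence.to T-∨)
                      (Equivalence.from T-∨ ∘ Sum.map (Equivalence.from a⇔A) (Equivalence.from b⇔B))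

  T-xor : ∀ {a b} → (T a × ¬ T b) ⊎ (¬ T a × T b) → T (a xor b)
  T-xor {true}  {false} _ = _
  T-xor {false} {true}  _ = _
  T-xor {true}  {true}  (inj₁ (_ , ¬b)) = ¬b _
  T-xor {true}  {true}  (inj₂ (¬a , _)) = ¬a _
  T-xor {false} {false} (inj₁ (a , _))  = a
  T-xor {false} {false} (inj₂ (_ , b))  = b

  T-not-does : ∀ {A : Set} (a? : Dec A) → ¬ A → T (not (does a?))
  T-not-does (false because _)   _  = _
  T-not-does (true  because [a]) ¬a = ¬a (invert [a])

  ind : Bool → ℕ
  ind false = 0
  ind true  = 1

  sum-mono-≤ : ∀ {n} {f g : Fin n → ℕ} → (∀ i → f i ≤ g i) → sum f ≤ sum g
  sum-mono-≤ {zero}  f≤g = z≤n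
  sum-mono-≤ {suc n} f≤g = +-mono-≤ (f≤g zero) (sum-mono-≤ (f≤g ∘ suc))

  sum-const : ∀ n c → sum {n} (λ _ → c) ≡ n * c
  sum-const zero    c = refl
  sum-const (suc n) c = cong (c +_) (sum-const n c)

  sum-↑ : ∀ m {k} (f : Fin (m + k) → ℕ) → sum f ≡ sum (λ i → f (i ↑ˡ k)) + sum (λ j → f (m ↑ʳ j))
  sum-↑ zero    f = refl
  sum-↑ (suc m) f = trans (cong (f zero +_) (sum-↑ m (f ∘ suc))) (sym (+-assoc (f zero) _ _))

  length-filterᵇ-allFin : ∀ {n} (p : Fin n → Bool) → length (filterᵇ p (allFin n)) ≡ sum (ind ∘ p)
  length-filterᵇ-allFin p = go p id
    where
    go : ∀ {A : Set} {n} (p : A → Bool) (g : Fin n → A) → length (filterᵇ p (tabulate g)) ≡ sum (ind ∘ p ∘ g)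
    go {n = zero}  p g = refl
    go {n = suc n} p g with p (g zero)
    ... | true  = cong suc (go p (g ∘ suc))
    ... | false = go p (g ∘ suc)

  ind-mono : ∀ {a b} → (T a → T b) → ind a ≤ ind b
  ind-mono {false} _ = z≤n
  ind-mono {true} {true}  _ = ≤-refl
  ind-mono {true} {false} h = ⊥-elim (h _)

  sum-ind-mono : ∀ {n} {p q : Fin n → Bool} → (∀ i → T (p i) → T (q i)) → sum (ind ∘ p) ≤ sum (ind ∘ q)
  sum-ind-mono p⇒q = sum-mono-≤ (λ i → ind-mono (p⇒q i))

  sum-ind-cong : ∀ {n} {p q : Fin n → Bool} → (∀ i → T (p i) ⇔ T (q i)) → sum (ind ∘ p) ≡ sum (ind ∘ q)
  sum-ind-cong p⇔q = ≤-antisym (sum-ind-mono (Equivalence.to ∘ p⇔q)) (sum-ind-mono (Equivalence.from ∘ p⇔q))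

  sum-ind-none : ∀ {n} (p : Fin n → Bool) → (∀ i → ¬ T (p i)) → sum (ind ∘ p) ≡ 0
  sum-ind-none {n} p none = n≤0⇒n≡0 (begin
    sum (ind ∘ p)      ≤⟨ sum-ind-mono {q = λ _ → false} (λ i pi → none i pi) ⟩
    sum {n} (λ _ → 0) ≡⟨ sum-const n 0 ⟩
    n * 0              ≡⟨ *-zeroʳ n ⟩
    0                  ∎)
    where open ≤-Reasoning

  sum-ind-unique : ∀ {n} (p : Fin n → Bool) (a : Fin n) → T (p a) → (∀ i → T (p i) → i ≡ a) →
                   sum (ind ∘ p) ≡ 1
  sum-ind-unique p zero pa unique with p zero
  ... | true  = cong suc (sum-ind-none (p ∘ suc) λ i pi → contradiction (unique (suc i) pi) λ ())
  sum-ind-unique p (suc a) pa unique with p zero in eq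
  ... | true  = contradiction (unique zero (subst T (sym eq) _)) λ ()
  ... | false = sum-ind-unique (p ∘ suc) a pa (λ i pi → Finₚ.suc-injective (unique (suc i) pi))

  module _ {n : ℕ} where
    open import Data.List.Membership.DecPropositional (_≟ᶠ_ {n}) using (_∈?_)

    private
      ind-∷ : ∀ (x a : Fin n) xs → All (a ≢_) xs →
              ind (does (x ∈? (a ∷ xs))) ≡ ind (does (x ≟ᶠ a)) + ind (does (x ∈? xs))
      ind-∷ x a xs a∉xs with x ≟ᶠ a
      ... | no _ = refl
      ... | yes refl with a ∈? xs
      ...   | yes a∈xs = contradiction a∈xs (Allₚ.All¬⇒¬Any a∉xs)
      ...   | no _     = refl

    sum-ind-∈ : ∀ {xs} → Unique xs → sum (λ x → ind (does (x ∈? xs))) ≡ length xs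
    sum-ind-∈ {[]}     []             = sum-ind-none {n} _ (λ _ ())
    sum-ind-∈ {a ∷ xs} (a∉xs ∷ uxs) = begin
      sum (λ x → ind (does (x ∈? (a ∷ xs))))
        ≡⟨ sum-cong-≗ (λ x → ind-∷ x a xs a∉xs) ⟩
      sum (λ x → ind (does (x ≟ᶠ a)) + ind (does (x ∈? xs)))
        ≡⟨ ∑-distrib-+ (λ x → ind (does (x ≟ᶠ a))) _ ⟩
      sum (λ x → ind (does (x ≟ᶠ a))) + sum (λ x → ind (does (x ∈? xs)))
        ≡⟨ cong₂ _+_ (sum-ind-unique _ a (Equivalence.from (T-does⇔ (a ≟ᶠ a)) refl)
                                         (λ x → Equivalence.to (T-does⇔ (x ≟ᶠ a))))
                     (sum-ind-∈ uxs) ⟩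
      suc (length xs) ∎
      where open ≡-Reasoning

    module _ {xs : List (Fin n)} (uxs : Unique xs) {p : Fin n → Bool} where

      length≤sum-ind : All (T ∘ p) xs → length xs ≤ sum (ind ∘ p)
      length≤sum-ind pxs = subst (_≤ sum (ind ∘ p)) (sum-ind-∈ uxs)
        (sum-ind-mono (λ x x∈? → All.lookup pxs (Equivalence.to (T-does⇔ (x ∈? xs)) x∈?)))

      sum-ind≡length : (∀ x → T (p x) ⇔ x ∈ xs) → sum (ind ∘ p) ≡ length xs
      sum-ind≡length p⇔∈ = trans
        (sum-ind-cong (λ x → mk⇔ (Equivalence.from (T-does⇔ (x ∈? xs)) ∘ Equivalence.to (p⇔∈ x))
                                 (Equivalence.from (p⇔∈ x) ∘ Equivalence.to (T-does⇔ (x ∈? xs)))))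
        (sum-ind-∈ uxs)

  -- Orbits of a permutation

  least-witness : ∀ {P : ℕ → Set} → Decidable P → ∀ n → P n → ∃[ m ] P m × (∀ {k} → k < m → ¬ P k)
  least-witness {P} P? n Pn with search (suc n)
    where
    search : ∀ b → (∀ {k} → k < b → ¬ P k) ⊎ ∃[ m ] P m × (∀ {k} → k < m → ¬ P k)
    search zero = inj₁ λ ()
    search (suc b) with search b
    ... | inj₂ found = inj₂ found
    ... | inj₁ none with P? b
    ...   | yes Pb = inj₂ (b , Pb , none)
    ...   | no ¬Pb = inj₁ λ k<1+b → [ none , (λ { refl → ¬Pb }) ] (m<1+n⇒m<n∨m≡n k<1+b)
  ... | inj₁ none  = contradiction Pn (none (n<1+n n))
  ... | inj₂ found = found

  iter-+ : ∀ M (f : Dart M → Dart M) a b x → iter M f (a + b) x ≡ iter M f a (iter M f b x)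
  iter-+ M f zero    b x = refl
  iter-+ M f (suc a) b x = cong f (iter-+ M f a b x)

  iter-natural : ∀ M M′ {f : Dart M → Dart M} {g : Dart M′ → Dart M′} (h : Dart M → Dart M′) →
                 (∀ x → h (f x) ≡ g (h x)) → ∀ k x → h (iter M f k x) ≡ iter M′ g k (h x)
  iter-natural M M′ h h∘f≡g∘h zero    x = refl
  iter-natural M M′ {g = g} h h∘f≡g∘h (suc k) x = trans (h∘f≡g∘h _) (cong g (iter-natural M M′ h h∘f≡g∘h k x))

  _÷_ : ℕ → ℕ → ℕ
  P ÷ zero  = 0
  P ÷ suc k = P / suc k

  ÷-*-cancel : ∀ {P k} → 0 < k → k ∣ P → P ÷ k * k ≡ P
  ÷-*-cancel {k = suc k} _ k∣P = m/n*n≡m k∣P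

  ∣n! : ∀ {k n} → 0 < k → k ≤ n → k ∣ n !
  ∣n! {suc k} _ k≤n = ∣-trans (m∣m*n (k !)) (m≤n⇒m!∣n! k≤n)

  -- (k − 3) (k − 4) ≥ 0
  k*7≤12+k*k : ∀ k → k * 7 ≤ 12 + k * k
  k*7≤12+k*k 0 = z≤n
  k*7≤12+k*k 1 = ≤ᵇ⇒≤ _ _ _
  k*7≤12+k*k 2 = ≤ᵇ⇒≤ _ _ _
  k*7≤12+k*k 3 = ≤-refl
  k*7≤12+k*k 4 = ≤-refl
  k*7≤12+k*k 5 = ≤ᵇ⇒≤ _ _ _
  k*7≤12+k*k 6 = ≤ᵇ⇒≤ _ _ _
  k*7≤12+k*k k@(suc (suc (suc (suc (suc (suc (suc j))))))) = ≤-trans (*-monoʳ-≤ k (m≤m+n 7 j)) (m≤n+m (k * k) 12)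

  module Orbits (M : Map) (f f⁻ : Dart M → Dart M)
                (f∘f⁻ : ∀ x → f (f⁻ x) ≡ x) (f⁻∘f : ∀ x → f⁻ (f x) ≡ x) where

    private
      N = n M
      D = Dart M

    f^ f⁻^ : ℕ → D → D
    f^  = iter M f
    f⁻^ = iter M f⁻

    f^∘f⁻^ : ∀ k x → f^ k (f⁻^ k x) ≡ x
    f^∘f⁻^ zero    x = refl
    f^∘f⁻^ (suc k) x = begin
      f (f^ k (f⁻ (f⁻^ k x))) ≡⟨ iter-natural M M f (λ _ → refl) k _ ⟩
      f^ k (f (f⁻ (f⁻^ k x))) ≡⟨ cong (f^ k) (f∘f⁻ _) ⟩
      f^ k (f⁻^ k x)          ≡⟨ f^∘f⁻^ k x ⟩
      x                       ∎
      where open ≡-Reasoning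

    f⁻^∘f^ : ∀ k x → f⁻^ k (f^ k x) ≡ x
    f⁻^∘f^ zero    x = refl
    f⁻^∘f^ (suc k) x = begin
      f⁻ (f⁻^ k (f (f^ k x))) ≡⟨ iter-natural M M f⁻ (λ _ → refl) k _ ⟩
      f⁻^ k (f⁻ (f (f^ k x))) ≡⟨ cong (f⁻^ k) (f⁻∘f _) ⟩
      f⁻^ k (f^ k x)          ≡⟨ f⁻^∘f^ k x ⟩
      x                       ∎
      where open ≡-Reasoning

    f^-injective : ∀ k {x y} → f^ k x ≡ f^ k y → x ≡ y
    f^-injective k {x} {y} eq = trans (sym (f⁻^∘f^ k x)) (trans (cong (f⁻^ k) eq) (f⁻^∘f^ k y))

    private
      f^-returns : ∀ x i d → f^ i x ≡ f^ (i + suc d) x → f^ (suc d) x ≡ x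
      f^-returns x i d eq = f^-injective i (trans (sym (iter-+ M f i (suc d) x)) (sym eq))

      difference : ∀ {i j} → i < j → ∃[ d ] j ≡ i + suc d
      difference {i} (s≤s {n = j} i≤j) = j ∸ i , sym (trans (+-suc i (j ∸ i)) (cong suc (m+[n∸m]≡n i≤j)))

      eventually-returns : ∀ x → ∃[ d ] f^ (suc d) x ≡ x
      eventually-returns x with Finₚ.pigeonhole (n<1+n N) (λ (i : Fin (suc N)) → f^ (toℕ i) x)
      ... | i , j , i<j , fⁱx≡fʲx with difference i<j
      ...   | d , j≡i+1+d = d , f^-returns x (toℕ i) d (subst (λ m → f^ (toℕ i) x ≡ f^ m x) j≡i+1+d fⁱx≡fʲx)

      first-return : ∀ x → ∃[ d ] f^ (suc d) x ≡ x × (∀ {e} → e < d → f^ (suc e) x ≢ x)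
      first-return x = uncurry (least-witness (λ d → f^ (suc d) x ≟ᶠ x)) (eventually-returns x)

      opaque
        period : D → ℕ
        period x = suc (proj₁ (first-return x))

        f^period : ∀ x → f^ (period x) x ≡ x
        f^period x = proj₁ (proj₂ (first-return x))

        period-minimal : ∀ x {q} → 0 < q → q < period x → f^ q x ≢ x
        period-minimal x {suc q} _ q<p = proj₂ (proj₂ (first-return x)) (s≤s⁻¹ q<p)

        period>0 : ∀ x → 0 < period x
        period>0 x = z<s

      instance
        period-nonZero : ∀ {x} → NonZero (period x)
        period-nonZero {x} = >-nonZero (period>0 x)

      f^-period-distinct : ∀ x {i j} → i < j → j < period x → f^ i x ≢ f^ j x
      f^-period-distinct x {i} i<j j<p eq with difference i<j
      ... | d , refl = period-minimal x z<s (≤-<-trans (m≤n+m (suc d) i) j<p) (f^-returns x i d eq)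

      period≤N : ∀ x → period x ≤ N
      period≤N x with period x ≤? N
      ... | yes p≤N = p≤N
      ... | no p≰N with Finₚ.pigeonhole (≰⇒> p≰N) (λ (i : Fin (period x)) → f^ (toℕ i) x)
      ...   | i , j , i<j , eq = contradiction eq (f^-period-distinct x i<j (Finₚ.toℕ<n j))

      f^-mod-period : ∀ k x → f^ k x ≡ f^ (k % period x) x
      f^-mod-period k x = begin
        f^ k x                                  ≡⟨ cong (λ j → f^ j x) (m≡m%n+[m/n]*n k (period x)) ⟩
        f^ (k % period x + k / period x * period x) x ≡⟨ iter-+ M f (k % period x) _ x ⟩
        f^ (k % period x) (f^ (k / period x * period x) x) ≡⟨ cong (f^ (k % period x)) (f^-multiple (k / period x)) ⟩
        f^ (k % period x) x                     ∎
        where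
        open ≡-Reasoning
        f^-multiple : ∀ t → f^ (t * period x) x ≡ x
        f^-multiple zero    = refl
        f^-multiple (suc t) = trans (iter-+ M f (period x) (t * period x) x)
                                    (trans (cong (f^ (period x)) (f^-multiple t)) (f^period x))

    Orb-refl : ∀ x → Orb M f x x
    Orb-refl x = 0 , refl

    Orb-f : ∀ x → Orb M f x (f x)
    Orb-f x = 1 , refl

    Orb-f^ : ∀ k x → Orb M f x (f^ k x)
    Orb-f^ k x = k , refl

    Orb-trans : ∀ {x y z} → Orb M f x y → Orb M f y z → Orb M f x z
    Orb-trans {x} (k , refl) (j , refl) = j + k , iter-+ M f j k x

    private
      Orb-bounded : ∀ {x y} → Orb M f x y → ∃[ k ] k < period x × f^ k x ≡ y
      Orb-bounded {x} (k , refl) = k % period x , m%n<n k (period x) , sym (f^-mod-period k x)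

    Orb-sym : ∀ {x y} → Orb M f x y → Orb M f y x
    Orb-sym {x} o with Orb-bounded o
    ... | k , k<p , refl = period x ∸ k , (begin
      f^ (period x ∸ k) (f^ k x) ≡⟨ iter-+ M f (period x ∸ k) k x ⟨
      f^ (period x ∸ k + k) x    ≡⟨ cong (λ j → f^ j x) (m∸n+n≡m (<⇒≤ k<p)) ⟩
      f^ (period x) x            ≡⟨ f^period x ⟩
      x                          ∎)
      where open ≡-Reasoning

    orbᵇ⇔Orb : ∀ {x y} → T (orbᵇ M f x y) ⇔ Orb M f x y
    orbᵇ⇔Orb {x} {y} = mk⇔ sound complete
      where
      sound : T (orbᵇ M f x y) → Orb M f x y
      sound t with k , fᵏx≟y ← Any.satisfied (Anyₚ.any⁻ _ (upTo N) t) =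
        k , Equivalence.to (T-does⇔ (f^ k x ≟ᶠ y)) fᵏx≟y
      complete : Orb M f x y → T (orbᵇ M f x y)
      complete o with k , k<p , fᵏx≡y ← Orb-bounded o =
        Anyₚ.any⁺ _ (Any.map (λ { refl → Equivalence.from (T-does⇔ (f^ k x ≟ᶠ y)) fᵏx≡y })
                             (∈-upTo⁺ (≤-trans k<p (period≤N x))))

    private
      orbit : D → List D
      orbit x = applyUpTo (λ k → f^ k x) (period x)

      ∈-orbit⇔ : ∀ {x y} → T (orbᵇ M f x y) ⇔ y ∈ orbit x
      ∈-orbit⇔ {x} {y} = mk⇔
        (λ t → let k , k<p , fᵏx≡y = Orb-bounded (Equivalence.to orbᵇ⇔Orb t)
               in subst (_∈ orbit x) fᵏx≡y (∈-applyUpTo⁺ (λ k → f^ k x) k<p))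
        (λ y∈ → let k , _ , y≡fᵏx = ∈-applyUpTo⁻ (λ k → f^ k x) y∈
                in Equivalence.from orbᵇ⇔Orb (k , sym y≡fᵏx))

      orbSize≡period : ∀ x → orbSize M f x ≡ period x
      orbSize≡period x = begin
        orbSize M f x              ≡⟨ length-filterᵇ-allFin (orbᵇ M f x) ⟩
        sum {N} (ind ∘ orbᵇ M f x) ≡⟨ sum-ind≡length (AllPairsₚ.applyUpTo⁺₁ _ _ (f^-period-distinct x))
                                                     (λ _ → ∈-orbit⇔) ⟩
        length (orbit x)           ≡⟨ length-applyUpTo _ _ ⟩
        period x                   ∎
        where open ≡-Reasoning

    orbSize>0 : ∀ x → 0 < orbSize M f x
    orbSize>0 x = subst (0 <_) (sym (orbSize≡period x)) (period>0 x)

    orbSize≤n : ∀ x → orbSize M f x ≤ N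
    orbSize≤n x = subst (_≤ N) (sym (orbSize≡period x)) (period≤N x)

    f^orbSize : ∀ x → f^ (orbSize M f x) x ≡ x
    f^orbSize x = subst (λ p → f^ p x ≡ x) (sym (orbSize≡period x)) (f^period x)

    f^-distinct : ∀ x {i j} → i < j → j < orbSize M f x → f^ i x ≢ f^ j x
    f^-distinct x i<j j<s = f^-period-distinct x i<j (subst (_ <_) (orbSize≡period x) j<s)

    orbSize-unique : ∀ x {p} → 0 < p → f^ p x ≡ x → (∀ {q} → 0 < q → q < p → f^ q x ≢ x) → orbSize M f x ≡ p
    orbSize-unique x {p} 0<p fᵖx≡x minimal with <-cmp (period x) p
    ... | tri< per<p _ _ = contradiction (f^period x) (minimal (period>0 x) per<p)
    ... | tri≈ _ per≡p _ = trans (orbSize≡period x) per≡p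
    ... | tri> _ _ p<per = contradiction fᵖx≡x (period-minimal x 0<p p<per)

    orbSize-cong : ∀ {x y} → Orb M f x y → orbSize M f x ≡ orbSize M f y
    orbSize-cong {x} {y} o = begin
      orbSize M f x           ≡⟨ length-filterᵇ-allFin (orbᵇ M f x) ⟩
      sum {N} (ind ∘ orbᵇ M f x) ≡⟨ sum-ind-cong {N} (λ z → mk⇔ (transport (Orb-sym o)) (transport o)) ⟩
      sum {N} (ind ∘ orbᵇ M f y) ≡⟨ length-filterᵇ-allFin (orbᵇ M f y) ⟨
      orbSize M f y           ∎
      where
      open ≡-Reasoning
      transport : ∀ {a b z} → Orb M f a b → T (orbᵇ M f b z) → T (orbᵇ M f a z)
      transport a~b t = Equivalence.from orbᵇ⇔Orb (Orb-trans a~b (Equivalence.to orbᵇ⇔Orb t))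

    private
      -- the predicate by which #orbits picks one dart per orbit
      leastᵇ : D → Bool
      leastᵇ c = all (λ k → toℕ c ≤ᵇ toℕ (f^ k c)) (upTo N)

      IsLeast : D → Set
      IsLeast c = ∀ x → Orb M f c x → toℕ c ≤ toℕ x

      leastᵇ⇔IsLeast : ∀ {c} → T (leastᵇ c) ⇔ IsLeast c
      leastᵇ⇔IsLeast {c} = mk⇔
        (λ t x o → let k , k<p , fᵏc≡x = Orb-bounded o in
          subst (λ x → toℕ c ≤ toℕ x) fᵏc≡x
            (≤ᵇ⇒≤ _ _ (Allₚ.applyUpTo⁻ id N (Allₚ.all⁺ _ (upTo N) t) (≤-trans k<p (period≤N c)))))
        (λ least → Allₚ.all⁻ _ (Allₚ.applyUpTo⁺₂ id N (λ k → ≤⇒≤ᵇ (least _ (Orb-f^ k c)))))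

      least-unique : ∀ {c c′} → IsLeast c → IsLeast c′ → Orb M f c c′ → c ≡ c′
      least-unique c-least c′-least o = Finₚ.toℕ-injective (≤-antisym (c-least _ o) (c′-least _ (Orb-sym o)))

      orbitMin : D → D
      orbitMin x = argmin toℕ x (orbit x)

      orbitMin-Orb : ∀ x → Orb M f x (orbitMin x)
      orbitMin-Orb x = argmin-all toℕ (Orb-refl x)
        (All.tabulate (λ y∈ → Equivalence.to orbᵇ⇔Orb (Equivalence.from ∈-orbit⇔ y∈)))

      orbitMin-least : ∀ x → IsLeast (orbitMin x)
      orbitMin-least x y o = All.lookup (f[argmin]≤f[xs] {f = toℕ} x (orbit x))
        (Equivalence.to ∈-orbit⇔ (Equivalence.from orbᵇ⇔Orb (Orb-trans (orbitMin-Orb x) o)))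

      sum-over-orbits : (g : D → ℕ) → (∀ {x y} → Orb M f x y → g x ≡ g y) →
                        sum g ≡ sum (λ c → ind (leastᵇ c) * (orbSize M f c * g c))
      sum-over-orbits g g-invariant = begin
        sum g
          ≡⟨ sum-cong-≗ (λ x → sym (trans (cong (_* g x) (one-least x)) (*-identityˡ (g x)))) ⟩
        sum (λ x → sum (λ c → ind (leastᵇ c ∧ orbᵇ M f c x)) * g x)
          ≡⟨ sum-cong-≗ (λ x → *-distribʳ-sum (g x) (λ c → ind (leastᵇ c ∧ orbᵇ M f c x))) ⟩
        sum (λ x → sum (λ c → ind (leastᵇ c ∧ orbᵇ M f c x) * g x))
          ≡⟨ ∑-comm (λ x c → ind (leastᵇ c ∧ orbᵇ M f c x) * g x) ⟩
        sum (λ c → sum (λ x → ind (leastᵇ c ∧ orbᵇ M f c x) * g x))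
          ≡⟨ sum-cong-≗ (λ c → sum-cong-≗ (factor c)) ⟩
        sum (λ c → sum (λ x → ind (leastᵇ c) * (ind (orbᵇ M f c x) * g c)))
          ≡⟨ sum-cong-≗ (λ c → *-distribˡ-sum (ind (leastᵇ c)) (λ x → ind (orbᵇ M f c x) * g c)) ⟨
        sum (λ c → ind (leastᵇ c) * sum (λ x → ind (orbᵇ M f c x) * g c))
          ≡⟨ sum-cong-≗ (λ c → cong (ind (leastᵇ c) *_) (size c)) ⟩
        sum (λ c → ind (leastᵇ c) * (orbSize M f c * g c)) ∎
        where
        open ≡-Reasoning
        one-least : ∀ x → sum (λ c → ind (leastᵇ c ∧ orbᵇ M f c x)) ≡ 1
        one-least x = sum-ind-unique _ (orbitMin x)
          (Equivalence.from T-∧ ( Equivalence.from leastᵇ⇔IsLeast (orbitMin-least x)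
                                , Equivalence.from orbᵇ⇔Orb (Orb-sym (orbitMin-Orb x))))
          (λ c t → let c-least , c~x = Equivalence.to T-∧ t in
            least-unique (Equivalence.to leastᵇ⇔IsLeast c-least) (orbitMin-least x)
                         (Orb-trans (Equivalence.to orbᵇ⇔Orb c~x) (orbitMin-Orb x)))
        factor : ∀ c x → ind (leastᵇ c ∧ orbᵇ M f c x) * g x ≡ ind (leastᵇ c) * (ind (orbᵇ M f c x) * g c)
        factor c x with leastᵇ c | orbᵇ M f c x in c~x
        ... | false | _     = refl
        ... | true  | false = refl
        ... | true  | true  = trans (*-identityˡ _) (trans (sym (g-invariant (Equivalence.to orbᵇ⇔Orb (subst T (sym c~x) _))))
                                     (sym (trans (*-identityˡ _) (*-identityˡ _))))
        size : ∀ c → sum (λ x → ind (orbᵇ M f c x) * g c) ≡ orbSize M f c * g c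
        size c = sym (trans (cong (_* g c) (length-filterᵇ-allFin (orbᵇ M f c))) (*-distribʳ-sum (g c) (ind ∘ orbᵇ M f c)))

      #orbits≡sum-least : #orbits M f ≡ sum (ind ∘ leastᵇ)
      #orbits≡sum-least = length-filterᵇ-allFin leastᵇ

    #orbits*P≡sum : ∀ P (w : D → ℕ) → (∀ x → w x * orbSize M f x ≡ P) → #orbits M f * P ≡ sum w
    #orbits*P≡sum P w w*size≡P = begin
      #orbits M f * P                                    ≡⟨ cong (_* P) #orbits≡sum-least ⟩
      sum (ind ∘ leastᵇ) * P                             ≡⟨ *-distribʳ-sum P (ind ∘ leastᵇ) ⟩
      sum (λ c → ind (leastᵇ c) * P)                     ≡⟨ sum-cong-≗ (λ c → cong (ind (leastᵇ c) *_) (P≡size*w c)) ⟩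
      sum (λ c → ind (leastᵇ c) * (orbSize M f c * w c)) ≡⟨ sum-over-orbits w w-invariant ⟨
      sum w                                              ∎
      where
      open ≡-Reasoning
      P≡size*w : ∀ x → P ≡ orbSize M f x * w x
      P≡size*w x = trans (sym (w*size≡P x)) (*-comm (w x) _)
      w-invariant : ∀ {x y} → Orb M f x y → w x ≡ w y
      w-invariant {x} {y} o = *-cancelʳ-≡ (w x) (w y) (orbSize M f y) {{>-nonZero (orbSize>0 y)}}
        (trans (cong (w x *_) (sym (orbSize-cong o))) (trans (w*size≡P x) (sym (w*size≡P y))))

    #orbits*K≡n : ∀ K → (∀ x → orbSize M f x ≡ K) → #orbits M f * K ≡ N
    #orbits*K≡n K size≡K = begin
      #orbits M f * K    ≡⟨ #orbits*P≡sum K (λ _ → 1) (λ x → trans (*-identityˡ _) (size≡K x)) ⟩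
      sum {N} (λ _ → 1)  ≡⟨ sum-const N 1 ⟩
      N * 1              ≡⟨ *-identityʳ N ⟩
      N                  ∎
      where open ≡-Reasoning

    7n≤12#orbits+∑orbSize : 7 * N ≤ 12 * #orbits M f + sum (orbSize M f)
    7n≤12#orbits+∑orbSize = begin
      7 * N
        ≡⟨ trans (*-comm 7 N) (sym (sum-const N 7)) ⟩
      sum {N} (λ _ → 7)
        ≡⟨ sum-over-orbits (λ _ → 7) (λ _ → refl) ⟩
      sum (λ c → ind (leastᵇ c) * (orbSize M f c * 7))
        ≤⟨ sum-mono-≤ (λ c → *-monoʳ-≤ (ind (leastᵇ c)) (k*7≤12+k*k (orbSize M f c))) ⟩
      sum (λ c → ind (leastᵇ c) * (12 + orbSize M f c * orbSize M f c))
        ≡⟨ sum-cong-≗ (λ c → *-distribˡ-+ (ind (leastᵇ c)) 12 _) ⟩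
      sum (λ c → ind (leastᵇ c) * 12 + ind (leastᵇ c) * (orbSize M f c * orbSize M f c))
        ≡⟨ ∑-distrib-+ (λ c → ind (leastᵇ c) * 12) _ ⟩
      sum (λ c → ind (leastᵇ c) * 12) + sum (λ c → ind (leastᵇ c) * (orbSize M f c * orbSize M f c))
        ≡⟨ cong₂ _+_ ∑12 (sum-over-orbits (orbSize M f) orbSize-cong) ⟨
      12 * #orbits M f + sum (orbSize M f) ∎
      where
      open ≤-Reasoning
      ∑12 : 12 * #orbits M f ≡ sum (λ c → ind (leastᵇ c) * 12)
      ∑12 = trans (*-comm 12 (#orbits M f)) (trans (cong (_* 12) #orbits≡sum-least) (*-distribʳ-sum 12 (ind ∘ leastᵇ)))

    -- #orbits = ∑ₓ 1 / |orbit of x|, multiplied through by P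
    #orbits*P≡∑P÷orbSize : ∀ P → (∀ x → orbSize M f x ∣ P) → #orbits M f * P ≡ sum (λ x → P ÷ orbSize M f x)
    #orbits*P≡∑P÷orbSize P size∣P = #orbits*P≡sum P (λ x → P ÷ orbSize M f x) (λ x → ÷-*-cancel (orbSize>0 x) (size∣P x))

  module _ {M M′ : Map} {f f⁻ : Dart M → Dart M} {g g⁻ : Dart M′ → Dart M′}
           (f∘f⁻ : ∀ x → f (f⁻ x) ≡ x) (f⁻∘f : ∀ x → f⁻ (f x) ≡ x)
           (g∘g⁻ : ∀ x → g (g⁻ x) ≡ x) (g⁻∘g : ∀ x → g⁻ (g x) ≡ x) where
    private
      module F = Orbits M f f⁻ f∘f⁻ f⁻∘f
      module G = Orbits M′ g g⁻ g∘g⁻ g⁻∘g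

    orbSize-transfer : ∀ {x y} → (∀ k → iter M f k x ≡ x → iter M′ g k y ≡ y) →
                       (∀ k → iter M′ g k y ≡ y → iter M f k x ≡ x) → orbSize M′ g y ≡ orbSize M f x
    orbSize-transfer {x} {y} f⇒g g⇒f = G.orbSize-unique y (F.orbSize>0 x) (f⇒g (orbSize M f x) (F.f^orbSize x))
      (λ {q} 0<q q<s gᵠy≡y → F.f^-distinct x 0<q q<s (sym (g⇒f q gᵠy≡y)))

  -- Parallel neighbours of an edge

  module _ (G : Map) where

    Shares : (Dart G → Dart G → Set) → Dart G → Dart G → Set
    Shares R d x = R d x ⊎ R d (α G x) ⊎ R (α G d) x ⊎ R (α G d) (α G x)

    DistinctEdges : Dart G → Dart G → Set
    DistinctEdges x y = x ≢ y × x ≢ α G y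

  private
    3+i<s : ∀ {i s} → i < s ∸ 3 → 3 + i < s
    3+i<s {s = suc (suc (suc s))} i<s∸3 = s≤s (s≤s (s≤s i<s∸3))

  -- used with (ρ, τ) = (σ, φ) for the edges at a vertex and (φ, σ) for the edges along a face
  module EdgesAround {G : Map} {ρ ρ⁻ τ τ⁻ : Dart G → Dart G}
      (ρ∘ρ⁻ : ∀ x → ρ (ρ⁻ x) ≡ x) (ρ⁻∘ρ : ∀ x → ρ⁻ (ρ x) ≡ x)
      (τ∘τ⁻ : ∀ x → τ (τ⁻ x) ≡ x) (τ⁻∘τ : ∀ x → τ⁻ (τ x) ≡ x)
      (α-τ-ρ : ∀ y → Orb G τ (α G y) (ρ y))
      (disk : ∀ {x y} → Orb G ρ x y → Orb G τ x y → x ≡ y)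
      (no-loop : ∀ y → ¬ Orb G ρ y (α G y)) where

    private
      module Rot = Orbits G ρ ρ⁻ ρ∘ρ⁻ ρ⁻∘ρ
      module Oth = Orbits G τ τ⁻ τ∘τ⁻ τ⁻∘τ

    edgesAround : Dart G → List (Dart G)
    edgesAround d = applyUpTo (λ i → Rot.f^ (2 + i) d) (orbSize G ρ d ∸ 3)

    module _ (d : Dart G) where
      private
        s = orbSize G ρ d

        τ-distinct : ∀ {a b} → a < b → b < s → ¬ Orb G τ (Rot.f^ a d) (Rot.f^ b d)
        τ-distinct {a} {b} a<b b<s o = Rot.f^-distinct d a<b b<s
          (disk (Rot.Orb-trans (Rot.Orb-sym (Rot.Orb-f^ a d)) (Rot.Orb-f^ b d)) o)

      length-edgesAround : length (edgesAround d) ≡ s ∸ 3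
      length-edgesAround = length-applyUpTo _ _

      edgesAround-spec : All (λ x → Orb G ρ d x × ¬ Shares G (Orb G τ) d x × DistinctEdges G x d) (edgesAround d)
      -- each way of sharing a τ-orbit puts two distinct ρ-iterates of d into one τ-orbit
      edgesAround-spec = Allₚ.applyUpTo⁺₁ _ _ λ {i} i<s∸3 →
        let k+1<s = 3+i<s i<s∸3
            k<s   = <-trans (n<1+n _) k+1<s
        in  Rot.Orb-f^ (2 + i) d
          , [ τ-distinct z<s k<s
            , [ (λ d~αx → τ-distinct z<s k+1<s (Oth.Orb-trans d~αx (α-τ-ρ _)))
              , [ (λ αd~x → τ-distinct (s≤s (s≤s z≤n)) k<s (Oth.Orb-trans (Oth.Orb-sym (α-τ-ρ d)) αd~x))
                , (λ αd~αx → τ-distinct (s≤s (s≤s z≤n)) k+1<s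
                               (Oth.Orb-trans (Oth.Orb-sym (α-τ-ρ d)) (Oth.Orb-trans αd~αx (α-τ-ρ _)))) ] ] ]
          , (λ x≡d → Rot.f^-distinct d z<s k<s (sym x≡d))
          , (λ x≡αd → no-loop d (subst (Orb G ρ d) x≡αd (Rot.Orb-f^ (2 + i) d)))

      edgesAround-pairwise : AllPairs (DistinctEdges G) (edgesAround d)
      edgesAround-pairwise = AllPairsₚ.applyUpTo⁺₁ _ _ λ {i} {j} i<j j<s∸3 →
          Rot.f^-distinct d (s≤s (s≤s i<j)) (<-trans (n<1+n _) (3+i<s j<s∸3))
        , (λ x≡αy → no-loop (Rot.f^ (2 + j) d)
             (Rot.Orb-trans (Rot.Orb-sym (Rot.Orb-f^ (2 + j) d)) (subst (Orb G ρ d) x≡αy (Rot.Orb-f^ (2 + i) d))))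

  module OfMap {G : Map} (isMap : IsMap G) where
    open IsMap isMap

    φ⁻ : Dart G → Dart G
    φ⁻ d = α G (σ⁻ G d)

    φ∘φ⁻ : ∀ x → φ G (φ⁻ x) ≡ x
    φ∘φ⁻ x = trans (cong (σ G) (αα (σ⁻ G x))) (σσ⁻ x)

    φ⁻∘φ : ∀ x → φ⁻ (φ G x) ≡ x
    φ⁻∘φ x = trans (cong (α G) (σ⁻σ (α G x))) (αα x)

    module Vertices = Orbits G (σ G) (σ⁻ G) σσ⁻ σ⁻σ
    module Faces    = Orbits G (φ G) φ⁻ φ∘φ⁻ φ⁻∘φ
    module Edges    = Orbits G (α G) (α G) αα αα

    α-injective : ∀ {x y} → α G x ≡ α G y → x ≡ y
    α-injective {x} {y} eq = trans (sym (αα x)) (trans (cong (α G) eq) (αα y))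

    edge-size : ∀ d → orbSize G (α G) d ≡ 2
    edge-size d = Edges.orbSize-unique d z<s (αα d) λ { {1} _ _ → α-fpf d ; {suc (suc _)} _ (s≤s (s≤s ())) }

    #E*2≡n : #E G * 2 ≡ n G
    #E*2≡n = Edges.#orbits*K≡n 2 edge-size

    sum-∘α : ∀ (g : Dart G → ℕ) → sum (g ∘ α G) ≡ sum g
    sum-∘α g = sym (∑-permute g (Perm.permutation (α G) (α G) αα αα))

    Shares-αʳ : ∀ R {d x} → Shares G R d x → Shares G R d (α G x)
    Shares-αʳ R {d} {x} =
      [ inj₂ ∘ inj₁ ∘ subst (R d) (sym (αα x))
      , [ inj₁
        , [ inj₂ ∘ inj₂ ∘ inj₂ ∘ subst (R (α G d)) (sym (αα x))
          , inj₂ ∘ inj₂ ∘ inj₁ ] ] ]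

    Shares-αˡ : ∀ R {d x} → Shares G R d x → Shares G R (α G d) x
    Shares-αˡ R {d} {x} =
      [ inj₂ ∘ inj₂ ∘ inj₁ ∘ subst (λ e → R e x) (sym (αα d))
      , [ inj₂ ∘ inj₂ ∘ inj₂ ∘ subst (λ e → R e (α G x)) (sym (αα d))
        , [ inj₁
          , inj₂ ∘ inj₁ ] ] ]

    Shares-αʳ⁻¹ : ∀ R {d x} → Shares G R d (α G x) → Shares G R d x
    Shares-αʳ⁻¹ R {d} {x} = subst (Shares G R d) (αα x) ∘ Shares-αʳ R {d} {α G x}

    Shares-αˡ⁻¹ : ∀ R {d x} → Shares G R (α G d) x → Shares G R d x
    Shares-αˡ⁻¹ R {d} {x} = subst (λ e → Shares G R e x) (αα d) ∘ Shares-αˡ R {α G d} {x}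

    DistinctEdges-αʳ : ∀ {x d} → DistinctEdges G x (α G d) → DistinctEdges G x d
    DistinctEdges-αʳ {x} {d} (x≢αd , x≢ααd) = (λ x≡d → x≢ααd (trans x≡d (sym (αα d)))) , x≢αd

    DistinctEdges-αˡ : ∀ {x d} → DistinctEdges G x d → DistinctEdges G (α G x) d
    DistinctEdges-αˡ {x} {d} (x≢d , x≢αd) =
      (λ αx≡d → x≢αd (trans (sym (αα x)) (cong (α G) αx≡d))) , (λ αx≡αd → x≢d (α-injective αx≡αd))

  module ParallelNeighbours {G : Map} (isMap : IsMap G) where
    open IsMap isMap
    open OfMap isMap

    ParallelNeighbour : Dart G → Dart G → Set
    ParallelNeighbour d x = DistinctEdges G x d ×
      (  Shares G (SameVertex G) d x × ¬ Shares G (SameFace G) d x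
      ⊎ ¬ Shares G (SameVertex G) d x × Shares G (SameFace G) d x)

    private
      V F : Dart G → Dart G → Set
      V = SameVertex G
      F = SameFace G

    ParallelNeighbour-αʳ : ∀ {d x} → ParallelNeighbour d x → ParallelNeighbour d (α G x)
    ParallelNeighbour-αʳ (distinct , shares) =
      DistinctEdges-αˡ distinct ,
      Sum.map (Product.map (Shares-αʳ V) (_∘ Shares-αʳ⁻¹ F)) (Product.map (_∘ Shares-αʳ⁻¹ V) (Shares-αʳ F)) shares

    ParallelNeighbour-αˡ : ∀ {d x} → ParallelNeighbour (α G d) x → ParallelNeighbour d x
    ParallelNeighbour-αˡ (distinct , shares) =
      DistinctEdges-αʳ distinct ,
      Sum.map (Product.map (Shares-αˡ⁻¹ V) (_∘ Shares-αˡ F)) (Product.map (_∘ Shares-αˡ V) (Shares-αˡ⁻¹ F)) shares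

    private
      T-shares⇔ : ∀ {r : Dart G → Dart G → Bool} {R} → (∀ {a b} → T (r a b) ⇔ R a b) → ∀ {d x} →
                  T (r d x ∨ r d (α G x) ∨ r (α G d) x ∨ r (α G d) (α G x)) ⇔ Shares G R d x
      T-shares⇔ r⇔R = T-∨⇔⊎ r⇔R (T-∨⇔⊎ r⇔R (T-∨⇔⊎ r⇔R r⇔R))

      parallelᵇ : ∀ {d y} → ParallelNeighbour d y → T (toℕ y <ᵇ toℕ (α G y)) → T (isParallelNeighbourᵇ G d y)
      parallelᵇ {d} {y} ((y≢d , y≢αd) , shares) canonical = Equivalence.from T-∧ (canonical ,
        Equivalence.from T-∧ (T-not-does (y ≟ᶠ d) y≢d ,
        Equivalence.from T-∧ (T-not-does (y ≟ᶠ α G d) y≢αd ,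
        T-xor (Sum.map (Product.map (Equivalence.from endpoint⇔) (_∘ Equivalence.to face⇔))
                       (Product.map (_∘ Equivalence.to endpoint⇔) (Equivalence.from face⇔)) shares))))
        where
        endpoint⇔ : T (sharesEndpointᵇ G d y) ⇔ Shares G V d y
        endpoint⇔ = T-shares⇔ {orbᵇ G (σ G)} {V} Vertices.orbᵇ⇔Orb
        face⇔ : T (sharesFaceᵇ G d y) ⇔ Shares G F d y
        face⇔ = T-shares⇔ {orbᵇ G (φ G)} {F} Faces.orbᵇ⇔Orb

    -- the dart by which #parallel counts an edge
    edgeRep : Dart G → Dart G
    edgeRep x = if toℕ x <ᵇ toℕ (α G x) then x else α G x

    edgeRep-spec : ∀ x → (edgeRep x ≡ x ⊎ edgeRep x ≡ α G x) × T (toℕ (edgeRep x) <ᵇ toℕ (α G (edgeRep x)))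
    edgeRep-spec x with toℕ x <ᵇ toℕ (α G x) in x<ᵇαx
    ... | true  = inj₁ refl , subst T (sym x<ᵇαx) _
    ... | false = inj₂ refl , subst (λ y → T (toℕ (α G x) <ᵇ toℕ y)) (sym (αα x)) (<⇒<ᵇ αx<x)
      where
      αx<x : toℕ (α G x) < toℕ x
      αx<x = ≤∧≢⇒< (≮⇒≥ (λ x<αx → subst T x<ᵇαx (<⇒<ᵇ x<αx)))
                   (λ αx≡x → α-fpf x (Finₚ.toℕ-injective αx≡x))

    edgeRep-injective : ∀ {x y} → DistinctEdges G x y → edgeRep x ≢ edgeRep y
    edgeRep-injective {x} {y} (x≢y , x≢αy) eq
      with proj₁ (edgeRep-spec x) | proj₁ (edgeRep-spec y)
    ... | inj₁ ex | inj₁ ey = x≢y (trans (sym ex) (trans eq ey))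
    ... | inj₁ ex | inj₂ ey = x≢αy (trans (sym ex) (trans eq ey))
    ... | inj₂ ex | inj₁ ey = x≢αy (trans (sym (αα x)) (cong (α G) (trans (sym ex) (trans eq ey))))
    ... | inj₂ ex | inj₂ ey = x≢y (α-injective (trans (sym ex) (trans eq ey)))

    edgeRep-parallel : ∀ {d x} → ParallelNeighbour d x → T (isParallelNeighbourᵇ G d (edgeRep x))
    edgeRep-parallel {d} {x} pn with edgeRep-spec x
    ... | inj₁ ex , canonical = parallelᵇ (subst (ParallelNeighbour d) (sym ex) pn) canonical
    ... | inj₂ ex , canonical = parallelᵇ (subst (ParallelNeighbour d) (sym ex) (ParallelNeighbour-αʳ pn)) canonical

    length≤#parallel : ∀ {d xs} → AllPairs (DistinctEdges G) xs → All (ParallelNeighbour d) xs →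
                       length xs ≤ #parallel G d
    length≤#parallel {d} {xs} pairwise parallel = begin
      length xs                           ≡⟨ length-map edgeRep xs ⟨
      length (map edgeRep xs)             ≤⟨ length≤sum-ind unique (Allₚ.map⁺ (All.map edgeRep-parallel parallel)) ⟩
      sum (ind ∘ isParallelNeighbourᵇ G d) ≡⟨ length-filterᵇ-allFin (isParallelNeighbourᵇ G d) ⟨
      #parallel G d                       ∎
      where
      open ≤-Reasoning
      unique : Unique (map edgeRep xs)
      unique = AllPairsₚ.map⁺ (AllPairs.map edgeRep-injective pairwise)

  -- Tessellations with positive curvature

  positive-4-k⇒k≤3 : ∀ k → 0ℤ ℤ.< ℤ.+ 4 ℤ.- ℤ.+ k → k ≤ 3
  positive-4-k⇒k≤3 k 0<4-k with k ≤? 3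
  ... | yes k≤3 = k≤3
  ... | no  k≰3 = contradiction 0<4-k (ℤₚ.≤⇒≯ (ℤₚ.≤-trans (ℤₚ.≤-reflexive 4-k≡-[k∸4]) ℤₚ.neg-≤-pos))
    where
    4-k≡-[k∸4] : ℤ.+ 4 ℤ.- ℤ.+ k ≡ ℤ.- (ℤ.+ (k ∸ 4))
    4-k≡-[k∸4] = trans (ℤₚ.[+m]-[+n]≡m⊖n 4 k) (ℤₚ.⊖-≤ (≰⇒> k≰3))

  sum≤sum∸3+12 : ∀ {a b c e} → 3 ≤ a → 3 ≤ b → 3 ≤ c → 3 ≤ e →
                 a + b + c + e ≤ (a ∸ 3) + ((b ∸ 3) + ((c ∸ 3) + (e ∸ 3))) + 12
  sum≤sum∸3+12 (s≤s (s≤s (s≤s (z≤n {a})))) (s≤s (s≤s (s≤s (z≤n {b}))))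
               (s≤s (s≤s (s≤s (z≤n {c})))) (s≤s (s≤s (s≤s (z≤n {e})))) =
    ≤-reflexive (rearrange a b c e)
    where
    rearrange : ∀ a b c e → 3 + a + (3 + b) + (3 + c) + (3 + e) ≡ a + (b + (c + e)) + 12
    rearrange = solve-∀

  -- Σv = ∑_d |vertex of d| = ∑_v |v|², likewise Σf, and there are 2E darts
  edges≤24 : ∀ {E V F Σv Σf} → 2 * (Σv + Σf) ≤ 15 * (E * 2) →
             7 * (E * 2) ≤ 12 * V + Σv → 7 * (E * 2) ≤ 12 * F + Σf → V + F ≡ E + 2 → E ≤ 24
  edges≤24 {E} {V} {F} {Σv} {Σf} degrees vertices faces euler =
    *-cancelˡ-≤ 2 (+-cancelˡ-≤ (54 * E) (2 * E) 48 (begin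
      54 * E + 2 * E                            ≡⟨ lhs E ⟩
      2 * (7 * (E * 2) + 7 * (E * 2))           ≤⟨ *-monoʳ-≤ 2 (+-mono-≤ vertices faces) ⟩
      2 * ((12 * V + Σv) + (12 * F + Σf))       ≡⟨ middle V Σv F Σf ⟩
      24 * (V + F) + 2 * (Σv + Σf)              ≤⟨ +-mono-≤ (≤-reflexive (cong (24 *_) euler)) degrees ⟩
      24 * (E + 2) + 15 * (E * 2)               ≡⟨ rhs E ⟩
      54 * E + 48                               ∎))
    where
    open ≤-Reasoning
    lhs : ∀ E → 54 * E + 2 * E ≡ 2 * (7 * (E * 2) + 7 * (E * 2))
    lhs = solve-∀
    middle : ∀ V Σv F Σf → 2 * ((12 * V + Σv) + (12 * F + Σf)) ≡ 24 * (V + F) + 2 * (Σv + Σf)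
    middle = solve-∀
    rhs : ∀ E → 24 * (E + 2) + 15 * (E * 2) ≡ 54 * E + 48
    rhs = solve-∀

  module OfTessellation {G : Map} (tess : Tessellation G) where
    open Tessellation tess
    open IsMap isMap
    open OfMap isMap public
    open ParallelNeighbours isMap

    no-loop : ∀ d → ¬ SameVertex G d (α G d)
    no-loop = proj₁ simple

    face-disk-≡ : ∀ {x y} → SameFace G x y → SameVertex G x y → x ≡ y
    face-disk-≡ {x} {y} x~y x≈y with x ≟ᶠ y
    ... | yes x≡y = x≡y
    ... | no  x≢y = contradiction x≈y (face-disk x y x~y x≢y)

    σ-on-face-of-α : ∀ y → SameFace G (α G y) (σ G y)
    σ-on-face-of-α y = 1 , cong (σ G) (αα y)

    φ-at-vertex-of-α : ∀ y → SameVertex G (α G y) (φ G y)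
    φ-at-vertex-of-α y = 1 , refl

    module AtVertex = EdgesAround σσ⁻ σ⁻σ φ∘φ⁻ φ⁻∘φ σ-on-face-of-α (λ v f → face-disk-≡ f v) no-loop
    module AlongFace = EdgesAround φ∘φ⁻ φ⁻∘φ σσ⁻ σ⁻σ φ-at-vertex-of-α face-disk-≡ two-faces

    degreeSum : Dart G → ℕ
    degreeSum d = vdeg G d + vdeg G (α G d) + fdeg G d + fdeg G (α G d)

    private
      V F : Dart G → Dart G → Set
      V = SameVertex G
      F = SameFace G

      parallelCandidates : Dart G → List (Dart G)
      parallelCandidates d = AtVertex.edgesAround d ++ AtVertex.edgesAround (α G d)
                          ++ AlongFace.edgesAround d ++ AlongFace.edgesAround (α G d)

      length-parallelCandidates : ∀ d → length (parallelCandidates d) ≡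
        (vdeg G d ∸ 3) + ((vdeg G (α G d) ∸ 3) + ((fdeg G d ∸ 3) + (fdeg G (α G d) ∸ 3)))
      length-parallelCandidates d =
        trans (length-++ (AtVertex.edgesAround d)) (cong₂ _+_ (AtVertex.length-edgesAround d)
        (trans (length-++ (AtVertex.edgesAround (α G d))) (cong₂ _+_ (AtVertex.length-edgesAround (α G d))
        (trans (length-++ (AlongFace.edgesAround d)) (cong₂ _+_ (AlongFace.length-edgesAround d)
               (AlongFace.length-edgesAround (α G d)))))))

      candidates-parallel : ∀ d → All (ParallelNeighbour d) (parallelCandidates d)
      candidates-parallel d =
        Allₚ.++⁺ (All.map at-vertex (AtVertex.edgesAround-spec d)) (Allₚ.++⁺
        (All.map (ParallelNeighbour-αˡ ∘ at-vertex) (AtVertex.edgesAround-spec (α G d))) (Allₚ.++⁺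
        (All.map along-face (AlongFace.edgesAround-spec d))
        (All.map (ParallelNeighbour-αˡ ∘ along-face) (AlongFace.edgesAround-spec (α G d)))))
        where
        at-vertex : ∀ {d x} → V d x × ¬ Shares G F d x × DistinctEdges G x d → ParallelNeighbour d x
        at-vertex (d≈x , ¬shares , distinct) = distinct , inj₁ (inj₁ d≈x , ¬shares)
        along-face : ∀ {d x} → F d x × ¬ Shares G V d x × DistinctEdges G x d → ParallelNeighbour d x
        along-face (d~x , ¬shares , distinct) = distinct , inj₂ (¬shares , inj₁ d~x)

      opposite-ends-distinct : ∀ {d x y} → V d x → x ≢ d → V (α G d) y → DistinctEdges G x y
      opposite-ends-distinct {d} {x} {y} d≈x x≢d αd≈y =
          (λ x≡y → no-loop d (Vertices.Orb-trans d≈x (Vertices.Orb-sym (subst (V (α G d)) (sym x≡y) αd≈y))))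
        , (λ x≡αy → x≢d (sym (proj₂ simple d x d≈x
                               (subst (V (α G d)) (trans (sym (αα y)) (cong (α G) (sym x≡αy))) αd≈y))))

      endpoint-distinct : ∀ {d x y} → V d x ⊎ V (α G d) x → ¬ Shares G V d y → DistinctEdges G x y
      endpoint-distinct (inj₁ d≈x) ¬shares =
          (λ x≡y → ¬shares (inj₁ (subst (V _) x≡y d≈x)))
        , (λ x≡αy → ¬shares (inj₂ (inj₁ (subst (V _) x≡αy d≈x))))
      endpoint-distinct (inj₂ αd≈x) ¬shares =
          (λ x≡y → ¬shares (inj₂ (inj₂ (inj₁ (subst (V _) x≡y αd≈x)))))
        , (λ x≡αy → ¬shares (inj₂ (inj₂ (inj₂ (subst (V _) x≡αy αd≈x)))))

      opposite-faces-distinct : ∀ {d x y} → F d x → ¬ Shares G V d x → F (α G d) y → DistinctEdges G x y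
      opposite-faces-distinct {d} {x} {y} d~x ¬shares αd~y =
          (λ x≡y → two-faces d (Faces.Orb-trans d~x (Faces.Orb-sym (subst (F (α G d)) (sym x≡y) αd~y))))
        , three-common-vertices
        where
        three-common-vertices : x ≢ α G y
        three-common-vertices x≡αy = meet-≤2 d (α G d) (two-faces d) d (α G d) x
          (d , Faces.Orb-refl d , Vertices.Orb-refl d)
          (σ G d , σ-on-face-of-α d , Vertices.Orb-f d)
          (φ G d , Faces.Orb-f d , φ-at-vertex-of-α d)
          (α G d , Faces.Orb-refl (α G d) , Vertices.Orb-refl (α G d))
          (x , d~x , Vertices.Orb-refl x)
          (φ G y , Faces.Orb-trans αd~y (Faces.Orb-f y) , subst (λ z → V z (φ G y)) (sym x≡αy) (φ-at-vertex-of-α y))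
          (no-loop d) (¬shares ∘ inj₁) (¬shares ∘ inj₂ ∘ inj₂ ∘ inj₁)

      candidates-pairwise : ∀ d → AllPairs (DistinctEdges G) (parallelCandidates d)
      candidates-pairwise d =
        AllPairsₚ.++⁺ (AtVertex.edgesAround-pairwise d)
          (AllPairsₚ.++⁺ (AtVertex.edgesAround-pairwise (α G d))
            (AllPairsₚ.++⁺ (AlongFace.edgesAround-pairwise d) (AlongFace.edgesAround-pairwise (α G d)) faces×faces)
            vertex′×faces)
          vertex×rest
        where
        faceEdges = AlongFace.edgesAround d ++ AlongFace.edgesAround (α G d)

        ¬shares-faceEdges : All (¬_ ∘ Shares G V d) faceEdges
        ¬shares-faceEdges = Allₚ.++⁺
          (All.map (proj₁ ∘ proj₂) (AlongFace.edgesAround-spec d))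
          (All.map (λ (_ , ¬shares , _) → ¬shares ∘ Shares-αˡ V) (AlongFace.edgesAround-spec (α G d)))

        faces×faces : All (λ x → All (DistinctEdges G x) (AlongFace.edgesAround (α G d))) (AlongFace.edgesAround d)
        faces×faces = All.map (λ (d~x , ¬shares , _) → All.map (λ (αd~y , _ , _) → opposite-faces-distinct d~x ¬shares αd~y)
                                                               (AlongFace.edgesAround-spec (α G d)))
                              (AlongFace.edgesAround-spec d)

        vertex′×faces : All (λ x → All (DistinctEdges G x) faceEdges) (AtVertex.edgesAround (α G d))
        vertex′×faces = All.map (λ (αd≈x , _ , _) → All.map (endpoint-distinct (inj₂ αd≈x)) ¬shares-faceEdges)
                                (AtVertex.edgesAround-spec (α G d))

        vertex×rest : All (λ x → All (DistinctEdges G x) (AtVertex.edgesAround (α G d) ++ faceEdges))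
                              (AtVertex.edgesAround d)
        vertex×rest = All.map (λ (d≈x , _ , (x≢d , _)) → Allₚ.++⁺
                                 (All.map (λ (αd≈y , _ , _) → opposite-ends-distinct d≈x x≢d αd≈y)
                                          (AtVertex.edgesAround-spec (α G d)))
                                 (All.map (endpoint-distinct (inj₁ d≈x)) ¬shares-faceEdges))
                              (AtVertex.edgesAround-spec d)

    degreeSum≤#parallel+12 : ∀ d → degreeSum d ≤ #parallel G d + 12
    degreeSum≤#parallel+12 d = begin
      degreeSum d
        ≤⟨ sum≤sum∸3+12 (vdeg≥3 d) (vdeg≥3 (α G d)) (fdeg≥3 d) (fdeg≥3 (α G d)) ⟩
      (vdeg G d ∸ 3) + ((vdeg G (α G d) ∸ 3) + ((fdeg G d ∸ 3) + (fdeg G (α G d) ∸ 3))) + 12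
        ≡⟨ cong (_+ 12) (length-parallelCandidates d) ⟨
      length (parallelCandidates d) + 12
        ≤⟨ +-monoˡ-≤ 12 (length≤#parallel (candidates-pairwise d) (candidates-parallel d)) ⟩
      #parallel G d + 12 ∎
      where open ≤-Reasoning

    RicF≡4-#parallel : ∀ d → RicF G d ≡ ℤ.+ 4 ℤ.- ℤ.+ #parallel G d
    RicF≡4-#parallel d = cong (λ k → ℤ.+ k ℤ.- ℤ.+ #parallel G d) (cong₂ _+_ two-sides two-ends)
      where
      two-sides : #facesOf G d ≡ 2
      two-sides with orbᵇ G (φ G) d (α G d) in d~αd
      ... | true  = contradiction (Equivalence.to Faces.orbᵇ⇔Orb (subst T (sym d~αd) _)) (two-faces d)
      ... | false = refl
      two-ends : #endpointsOf G d ≡ 2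
      two-ends with orbᵇ G (σ G) d (α G d) in d≈αd
      ... | true  = contradiction (Equivalence.to Vertices.orbᵇ⇔Orb (subst T (sym d≈αd) _)) (no-loop d)
      ... | false = refl

    module _ (positive : ∀ e → 0ℤ ℤ.< RicF G e) where

      degreeSum≤15 : ∀ d → degreeSum d ≤ 15
      degreeSum≤15 d = ≤-trans (degreeSum≤#parallel+12 d)
        (+-monoˡ-≤ 12 (positive-4-k⇒k≤3 _ (subst (0ℤ ℤ.<_) (RicF≡4-#parallel d) (positive d))))

      #E≤24 : #E G ≤ 24
      #E≤24 = edges≤24 {#E G} {#V G} {#F G} degrees
        (subst (λ m → 7 * m ≤ 12 * #V G + Σv) (sym #E*2≡n) Vertices.7n≤12#orbits+∑orbSize)
        (subst (λ m → 7 * m ≤ 12 * #F G + Σf) (sym #E*2≡n) Faces.7n≤12#orbits+∑orbSize)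
        (proj₂ spherical)
        where
        Σv Σf : ℕ
        Σv = sum (vdeg G)
        Σf = sum (fdeg G)

        sum-degreeSum : sum degreeSum ≡ 2 * (Σv + Σf)
        sum-degreeSum = begin-equality
          sum degreeSum
            ≡⟨ ∑-distrib-+ (λ d → vdeg G d + vdeg G (α G d) + fdeg G d) (fdeg G ∘ α G) ⟩
          sum (λ d → vdeg G d + vdeg G (α G d) + fdeg G d) + sum (fdeg G ∘ α G)
            ≡⟨ cong₂ _+_ (∑-distrib-+ (λ d → vdeg G d + vdeg G (α G d)) (fdeg G)) (sum-∘α (fdeg G)) ⟩
          sum (λ d → vdeg G d + vdeg G (α G d)) + Σf + Σf
            ≡⟨ cong (λ s → s + Σf + Σf)
                    (trans (∑-distrib-+ (vdeg G) (vdeg G ∘ α G)) (cong (Σv +_) (sum-∘α (vdeg G)))) ⟩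
          Σv + Σv + Σf + Σf
            ≡⟨ double Σv Σf ⟩
          2 * (Σv + Σf) ∎
          where
          open ≤-Reasoning
          double : ∀ a b → a + a + b + b ≡ 2 * (a + b)
          double = solve-∀

        degrees : 2 * (Σv + Σf) ≤ 15 * (#E G * 2)
        degrees = begin
          2 * (Σv + Σf)      ≡⟨ sum-degreeSum ⟨
          sum degreeSum      ≤⟨ sum-mono-≤ degreeSum≤15 ⟩
          sum {n G} (λ _ → 15) ≡⟨ sum-const (n G) 15 ⟩
          n G * 15           ≡⟨ trans (*-comm (n G) 15) (cong (15 *_) (sym #E*2≡n)) ⟩
          15 * (#E G * 2)    ∎
          where open ≤-Reasoning


  -- Two-connectivity

  Reach-trans : ∀ {M : Map} {a b c} → Reach M a b → Reach M b c → Reach M a c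
  Reach-trans here         r = r
  Reach-trans (σ-step a→b) r = σ-step (Reach-trans a→b r)
  Reach-trans (α-step a→b) r = α-step (Reach-trans a→b r)

  module TwoConnectivity {M : Map} (isMap : IsMap M) (no-loop : ∀ d → ¬ SameVertex M d (α M d)) where
    open IsMap isMap
    private
      module Vertices = Orbits M (σ M) (σ⁻ M) σσ⁻ σ⁻σ

    module _ (v : Dart M) where

      ReachAvoid-trans : ∀ {a b c} → ReachAvoid M v a b → ReachAvoid M v b c → ReachAvoid M v a c
      ReachAvoid-trans here             r = r
      ReachAvoid-trans (σ-step v≉ a→b) r = σ-step v≉ (ReachAvoid-trans a→b r)
      ReachAvoid-trans (α-step v≉ a→b) r = α-step v≉ (ReachAvoid-trans a→b r)

      around-vertex : ∀ {d d′} → ¬ SameVertex M v d → SameVertex M d d′ → ReachAvoid M v d d′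
      around-vertex {d} v≉d (k , refl) = go k
        where
        go : ∀ k → ReachAvoid M v d (Vertices.f^ k d)
        go zero    = here
        go (suc k) = ReachAvoid-trans (go k)
          (σ-step (λ v≈ → v≉d (Vertices.Orb-trans v≈ (Vertices.Orb-sym (Vertices.Orb-f^ (suc k) d)))) here)

      LinkConnected : Set
      LinkConnected = ∀ x y → SameVertex M v x → SameVertex M v y → ReachAvoid M v (α M y) (α M x)

      linkConnected-forward : (∀ w → SameVertex M v w → ReachAvoid M v (α M w) (α M (σ M w))) → LinkConnected
      linkConnected-forward step x y v≈x v≈y with Vertices.Orb-trans (Vertices.Orb-sym v≈y) v≈x
      ... | k , refl = go k
        where
        go : ∀ k → ReachAvoid M v (α M y) (α M (Vertices.f^ k y))
        go zero    = here
        go (suc k) = ReachAvoid-trans (go k) (step _ (Vertices.Orb-trans v≈y (Vertices.Orb-f^ k y)))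

      linkConnected-backward : (∀ w → SameVertex M v w → ReachAvoid M v (α M (σ M w)) (α M w)) → LinkConnected
      linkConnected-backward step x y v≈x v≈y with Vertices.Orb-trans (Vertices.Orb-sym v≈x) v≈y
      ... | k , refl = go k
        where
        go : ∀ k → ReachAvoid M v (α M (Vertices.f^ k x)) (α M x)
        go zero    = here
        go (suc k) = ReachAvoid-trans (step _ (Vertices.Orb-trans v≈x (Vertices.Orb-f^ k x))) (go k)

      private
        v≈? : ∀ d → Dec (SameVertex M v d)
        v≈? d = map′ (Equivalence.to Vertices.orbᵇ⇔Orb) (Equivalence.from Vertices.orbᵇ⇔Orb) (T? (orbᵇ M (σ M) v d))

      -- whenever the walk enters v it is restarted at a neighbour of v, and LinkConnected
      -- joins that neighbour to the one where the walk leaves v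
      detour : LinkConnected → ∀ {x b} → Reach M x b → ¬ SameVertex M v b →
               (¬ SameVertex M v x → ReachAvoid M v x b) ×
               (SameVertex M v x → ∀ y → SameVertex M v y → ReachAvoid M v (α M y) b)
      detour link here v≉b = (λ _ → here) , (λ v≈b → contradiction v≈b v≉b)
      detour link {x} (σ-step x→b) v≉b with detour link x→b v≉b
      ... | avoid , from-v =
          (λ v≉x → σ-step (v≉x ∘ σ-back) (avoid (v≉x ∘ σ-back)))
        , (λ v≈x → from-v (Vertices.Orb-trans v≈x (Vertices.Orb-f x)))
        where
        σ-back : SameVertex M v (σ M x) → SameVertex M v x
        σ-back v≈σx = Vertices.Orb-trans v≈σx (Vertices.Orb-sym (Vertices.Orb-f x))
      detour link {x} (α-step x→b) v≉b with detour link x→b v≉b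
      ... | avoid , from-v = avoid′ , from-v′
        where
        avoid′ : ¬ SameVertex M v x → ReachAvoid M v x _
        avoid′ v≉x with v≈? (α M x)
        ... | yes v≈αx = subst (λ z → ReachAvoid M v z _) (αα x) (from-v v≈αx (α M x) v≈αx)
        ... | no  v≉αx = α-step v≉αx (avoid v≉αx)
        from-v′ : SameVertex M v x → ∀ y → SameVertex M v y → ReachAvoid M v (α M y) _
        from-v′ v≈x y v≈y = ReachAvoid-trans (link x y v≈x v≈y)
          (avoid (λ v≈αx → no-loop x (Vertices.Orb-trans (Vertices.Orb-sym v≈x) v≈αx)))

    twoConnected : Connected M → (∀ v → LinkConnected v) → TwoConnected M
    twoConnected connected link v a b v≉a v≉b = proj₁ (detour v (link v) (connected a b) v≉b) v≉a

  -- The dual of the medial map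

  -- decided by evaluation over the 4⁴ excesses (a − 3, b − 3, c − 3, e − 3)
  pattern-allowed : ∀ (M : Map) {a b c e} → 3 ≤ a → 3 ≤ b → 3 ≤ c → 3 ≤ e → a + b + c + e ≤ 15 →
                    sort (a ∷ b ∷ c ∷ e ∷ []) ∈ allowedPatterns M
  pattern-allowed M (s≤s (s≤s (s≤s (z≤n {i})))) (s≤s (s≤s (s≤s (z≤n {j})))) (s≤s (s≤s (s≤s (z≤n {k}))))
                    (s≤s (s≤s (s≤s (z≤n {l})))) sum≤15 =
    lookup (lookup (lookup (lookup table i<4) j<4) k<4) l<4 excess≤3
    where
    Allowed : ℕ → ℕ → ℕ → ℕ → Set
    Allowed i j k l = i + j + k + l ≤ 3 → sort (3 + i ∷ 3 + j ∷ 3 + k ∷ 3 + l ∷ []) ∈ allowedPatterns M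

    table : All (λ i → All (λ j → All (λ k → All (Allowed i j k) (upTo 4)) (upTo 4)) (upTo 4)) (upTo 4)
    table = toWitness {a? = All.all? (λ i → All.all? (λ j → All.all? (λ k → All.all? (λ l →
              (i + j + k + l ≤? 3) →-dec (sort (3 + i ∷ 3 + j ∷ 3 + k ∷ 3 + l ∷ []) ∈ᴸ? allowedPatterns M))
              (upTo 4)) (upTo 4)) (upTo 4)) (upTo 4)} _

    lookup : ∀ {P : ℕ → Set} → All P (upTo 4) → ∀ {m} → m < 4 → P m
    lookup = Allₚ.applyUpTo⁻ id 4

    rearrange : ∀ i j k l → 3 + i + (3 + j) + (3 + k) + (3 + l) ≡ 12 + (i + j + k + l)
    rearrange = solve-∀

    excess≤3 : i + j + k + l ≤ 3
    excess≤3 = +-cancelˡ-≤ 12 _ _ (subst (_≤ 15) (rearrange i j k l) sum≤15)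

    i<4 : i < 4
    i<4 = s≤s (≤-trans (≤-trans (m≤m+n i j) (≤-trans (m≤m+n (i + j) k) (m≤m+n (i + j + k) l))) excess≤3)
    j<4 : j < 4
    j<4 = s≤s (≤-trans (≤-trans (m≤n+m j i) (≤-trans (m≤m+n (i + j) k) (m≤m+n (i + j + k) l))) excess≤3)
    k<4 : k < 4
    k<4 = s≤s (≤-trans (≤-trans (m≤n+m k (i + j)) (m≤m+n (i + j + k) l)) excess≤3)
    l<4 : l < 4
    l<4 = s≤s (≤-trans (m≤n+m l (i + j + k)) excess≤3)

  module MedialDual {G : Map} (tess : Tessellation G) where
    open Tessellation tess
    open IsMap isMap
    open OfTessellation tess

    private
      N = n G

    H : Map
    H = dual (medial G)

    -- the medial darts (x,0) and (x,1) of the definition of medial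
    L R : Dart G → Dart H
    L x = x ↑ˡ N
    R x = N ↑ʳ x

    data View : Dart H → Set where
      isL : ∀ x → View (L x)
      isR : ∀ y → View (R y)

    view : ∀ d → View d
    view d with splitAt N d in eq
    ... | inj₁ x = subst View (Finₚ.splitAt⁻¹-↑ˡ eq) (isL x)
    ... | inj₂ y = subst View (Finₚ.splitAt⁻¹-↑ʳ eq) (isR y)

    L≢R : ∀ {x y} → L x ≢ R y
    L≢R {x} {y} eq with () ← trans (sym (Finₚ.splitAt-↑ˡ N x N)) (trans (cong (splitAt N) eq) (Finₚ.splitAt-↑ʳ N N y))

    L-injective : ∀ {x y} → L x ≡ L y → x ≡ y
    L-injective = Finₚ.↑ˡ-injective N _ _

    R-injective : ∀ {x y} → R x ≡ R y → x ≡ y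
    R-injective = Finₚ.↑ʳ-injective N _ _

    private
      on-L : ∀ {A : Set} (h : Dart G ⊎ Dart G → A) x → h (splitAt N (L x)) ≡ h (inj₁ x)
      on-L h x = cong h (Finₚ.splitAt-↑ˡ N x N)

      on-R : ∀ {A : Set} (h : Dart G ⊎ Dart G → A) y → h (splitAt N (R y)) ≡ h (inj₂ y)
      on-R h y = cong h (Finₚ.splitAt-↑ʳ N N y)

    α-L : ∀ x → α H (L x) ≡ R x
    α-L = on-L [ R , L ]

    α-R : ∀ y → α H (R y) ≡ L y
    α-R = on-R [ R , L ]

    σ-L : ∀ x → σ H (L x) ≡ L (α G (σ G x))
    σ-L x = trans (cong (σ (medial G)) (α-L x)) (on-R [ R ∘ σ⁻ G , (λ y → L (α G (σ G y))) ] x)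

    σ-R : ∀ y → σ H (R y) ≡ R (σ⁻ G y)
    σ-R y = trans (cong (σ (medial G)) (α-R y)) (on-L [ R ∘ σ⁻ G , (λ y → L (α G (σ G y))) ] y)

    σ⁻-L : ∀ x → σ⁻ H (L x) ≡ L (σ⁻ G (α G x))
    σ⁻-L x = trans (cong (α H) (on-L [ R ∘ σ⁻ G ∘ α G , L ∘ σ G ] x)) (α-R _)

    σ⁻-R : ∀ y → σ⁻ H (R y) ≡ R (σ G y)
    σ⁻-R y = trans (cong (α H) (on-R [ R ∘ σ⁻ G ∘ α G , L ∘ σ G ] y)) (α-L _)

    φ-L : ∀ x → φ H (L x) ≡ R (σ⁻ G x)
    φ-L x = trans (cong (σ H) (α-L x)) (σ-R x)

    φ-R : ∀ y → φ H (R y) ≡ L (α G (σ G y))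
    φ-R y = trans (cong (σ H) (α-R y)) (σ-L y)

    isMapᴴ : IsMap H
    isMapᴴ = record { σσ⁻ = σσ⁻ᴴ ; σ⁻σ = σ⁻σᴴ ; αα = ααᴴ ; α-fpf = α-fpfᴴ }
      where
      σσ⁻ᴴ : ∀ d → σ H (σ⁻ H d) ≡ d
      σσ⁻ᴴ d with view d
      ... | isL x = trans (cong (σ H) (σ⁻-L x)) (trans (σ-L _) (cong L (trans (cong (α G) (σσ⁻ (α G x))) (αα x))))
      ... | isR y = trans (cong (σ H) (σ⁻-R y)) (trans (σ-R _) (cong R (σ⁻σ y)))
      σ⁻σᴴ : ∀ d → σ⁻ H (σ H d) ≡ d
      σ⁻σᴴ d with view d
      ... | isL x = trans (cong (σ⁻ H) (σ-L x)) (trans (σ⁻-L _) (cong L (trans (cong (σ⁻ G) (αα (σ G x))) (σ⁻σ x))))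
      ... | isR y = trans (cong (σ⁻ H) (σ-R y)) (trans (σ⁻-R _) (cong R (σσ⁻ y)))
      ααᴴ : ∀ d → α H (α H d) ≡ d
      ααᴴ d with view d
      ... | isL x = trans (cong (α H) (α-L x)) (α-R x)
      ... | isR y = trans (cong (α H) (α-R y)) (α-L y)
      α-fpfᴴ : ∀ d → α H d ≢ d
      α-fpfᴴ d with view d
      ... | isL x = λ eq → L≢R (sym (trans (sym (α-L x)) eq))
      ... | isR y = λ eq → L≢R (trans (sym (α-R y)) eq)

    private
      module Hᵐ = IsMap isMapᴴ
      module Hᵒ = OfMap isMapᴴ

    -- the H-vertex of ℓ x is the face of x
    ℓ : Dart G → Dart H
    ℓ x = L (α G x)

    L≡ℓ∘α : ∀ x → L x ≡ ℓ (α G x)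
    L≡ℓ∘α x = cong L (sym (αα x))

    ℓ-injective : ∀ {x y} → ℓ x ≡ ℓ y → x ≡ y
    ℓ-injective = α-injective ∘ L-injective

    σ^-ℓ : ∀ k x → iter H (σ H) k (ℓ x) ≡ ℓ (Faces.f^ k x)
    σ^-ℓ k x = sym (iter-natural G H ℓ (λ y → sym (σ-L (α G y))) k x)

    σ^-R : ∀ k y → iter H (σ H) k (R y) ≡ R (Vertices.f⁻^ k y)
    σ^-R k y = sym (iter-natural G H R (λ y → sym (σ-R y)) k y)

    SameVertex-ℓ⇔ : ∀ {x x′} → SameVertex H (ℓ x) (ℓ x′) ⇔ SameFace G x x′
    SameVertex-ℓ⇔ {x} = mk⇔ (λ (k , e) → k , ℓ-injective (trans (sym (σ^-ℓ k x)) e))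
                            (λ (k , e) → k , trans (σ^-ℓ k x) (cong ℓ e))

    SameVertex-L⇔ : ∀ {x x′} → SameVertex H (L x) (L x′) ⇔ SameFace G (α G x) (α G x′)
    SameVertex-L⇔ {x} {x′} = subst₂ (λ a b → SameVertex H a b ⇔ SameFace G (α G x) (α G x′))
                                    (sym (L≡ℓ∘α x)) (sym (L≡ℓ∘α x′)) SameVertex-ℓ⇔

    SameVertex-R⇔ : ∀ {y y′} → SameVertex H (R y) (R y′) ⇔ SameVertex G y′ y
    SameVertex-R⇔ {y} {y′} = mk⇔
      (λ (k , e) → k , trans (cong (Vertices.f^ k) (sym (R-injective (trans (sym (σ^-R k y)) e)))) (Vertices.f^∘f⁻^ k y))
      (λ (k , e) → k , trans (σ^-R k y) (cong R (trans (cong (Vertices.f⁻^ k) (sym e)) (Vertices.f⁻^∘f^ k y′))))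

    ¬SameVertex-LR : ∀ {x y} → ¬ SameVertex H (L x) (R y)
    ¬SameVertex-LR {x} (k , e) = L≢R (trans (sym (σ^-ℓ k (α G x))) (trans (cong (iter H (σ H) k) (sym (L≡ℓ∘α x))) e))

    ¬SameVertex-RL : ∀ {x y} → ¬ SameVertex H (R y) (L x)
    ¬SameVertex-RL {x} {y} (k , e) = L≢R (trans (sym e) (σ^-R k y))

    vdeg-ℓ : ∀ x → vdeg H (ℓ x) ≡ fdeg G x
    vdeg-ℓ x = orbSize-transfer φ∘φ⁻ φ⁻∘φ Hᵐ.σσ⁻ Hᵐ.σ⁻σ
      (λ k φᵏx≡x → trans (σ^-ℓ k x) (cong ℓ φᵏx≡x))
      (λ k σᵏℓx≡ℓx → ℓ-injective (trans (sym (σ^-ℓ k x)) σᵏℓx≡ℓx))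

    vdeg-L : ∀ x → vdeg H (L x) ≡ fdeg G (α G x)
    vdeg-L x = trans (cong (vdeg H) (L≡ℓ∘α x)) (vdeg-ℓ (α G x))

    vdeg-R : ∀ y → vdeg H (R y) ≡ vdeg G y
    vdeg-R y = orbSize-transfer σσ⁻ σ⁻σ Hᵐ.σσ⁻ Hᵐ.σ⁻σ
      (λ k σᵏy≡y → trans (σ^-R k y) (cong R (trans (cong (Vertices.f⁻^ k) (sym σᵏy≡y)) (Vertices.f⁻^∘f^ k y))))
      (λ k σᵏRy≡Ry → trans (cong (Vertices.f^ k) (sym (R-injective (trans (sym (σ^-R k y)) σᵏRy≡Ry))))
                           (Vertices.f^∘f⁻^ k y))

    vdeg≥3ᴴ : ∀ d → 3 ≤ vdeg H d
    vdeg≥3ᴴ d with view d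
    ... | isL x = subst (3 ≤_) (sym (vdeg-L x)) (fdeg≥3 (α G x))
    ... | isR y = subst (3 ≤_) (sym (vdeg-R y)) (vdeg≥3 y)

    φ²-L : ∀ x → φ H (φ H (L x)) ≡ L (α G x)
    φ²-L x = trans (cong (φ H) (φ-L x)) (trans (φ-R _) (cong (λ z → L (α G z)) (σσ⁻ x)))

    φ³-L : ∀ x → φ H (φ H (φ H (L x))) ≡ R (σ⁻ G (α G x))
    φ³-L x = trans (cong (φ H) (φ²-L x)) (φ-L (α G x))

    quadrangular-L : ∀ x → fdeg H (L x) ≡ 4
    quadrangular-L x = Hᵒ.Faces.orbSize-unique (L x) z<s
      (trans (cong (φ H) (cong (φ H) (φ²-L x))) (trans (φ²-L (α G x)) (cong L (αα x))))
      λ { {1} _ _ eq → L≢R (sym (trans (sym (φ-L x)) eq))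
        ; {2} _ _ eq → α-fpf x (L-injective (trans (sym (φ²-L x)) eq))
        ; {3} _ _ eq → L≢R (sym (trans (sym (φ³-L x)) eq))
        ; {suc (suc (suc (suc _)))} _ (s≤s (s≤s (s≤s (s≤s ())))) }

    quadrangularᴴ : ∀ d → fdeg H d ≡ 4
    quadrangularᴴ d with view d
    ... | isL x = quadrangular-L x
    ... | isR y = trans (sym (Hᵒ.Faces.orbSize-cong (1 , trans (φ-L (σ G y)) (cong R (σ⁻σ y))))) (quadrangular-L (σ G y))

    #Eᴴ≡n : #E H ≡ N
    #Eᴴ≡n = *-cancelʳ-≡ (#E H) N 2 (trans Hᵒ.#E*2≡n (double N))
      where
      double : ∀ m → m + m ≡ m * 2
      double = solve-∀

    #Fᴴ≡#E : #F H ≡ #E G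
    #Fᴴ≡#E = *-cancelʳ-≡ (#F H) (#E G) 4 (begin
      #F H * 4            ≡⟨ Hᵒ.Faces.#orbits*K≡n 4 quadrangularᴴ ⟩
      N + N               ≡⟨ cong₂ _+_ #E*2≡n #E*2≡n ⟨
      #E G * 2 + #E G * 2 ≡⟨ double (#E G) ⟩
      #E G * 4            ∎)
      where
      open ≡-Reasoning
      double : ∀ m → m * 2 + m * 2 ≡ m * 4
      double = solve-∀

    #Vᴴ≡#F+#V : #V H ≡ #F G + #V G
    #Vᴴ≡#F+#V = *-cancelʳ-≡ (#V H) (#F G + #V G) P {{P-nonZero}} (begin
      #V H * P
        ≡⟨ Hᵒ.Vertices.#orbits*P≡∑P÷orbSize P (λ d → ∣n! (Hᵒ.Vertices.orbSize>0 d) (Hᵒ.Vertices.orbSize≤n d)) ⟩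
      sum (λ d → P ÷ vdeg H d)
        ≡⟨ sum-↑ N (λ d → P ÷ vdeg H d) ⟩
      sum (λ x → P ÷ vdeg H (L x)) + sum (λ y → P ÷ vdeg H (R y))
        ≡⟨ cong₂ _+_ (sum-cong-≗ (λ x → cong (P ÷_) (vdeg-L x))) (sum-cong-≗ (λ y → cong (P ÷_) (vdeg-R y))) ⟩
      sum (λ x → P ÷ fdeg G (α G x)) + sum (λ y → P ÷ vdeg G y)
        ≡⟨ cong (_+ sum (λ y → P ÷ vdeg G y)) (sum-∘α (λ x → P ÷ fdeg G x)) ⟩
      sum (λ x → P ÷ fdeg G x) + sum (λ y → P ÷ vdeg G y)
        ≡⟨ cong₂ _+_ (Faces.#orbits*P≡∑P÷orbSize P (size∣P Faces.orbSize>0 Faces.orbSize≤n))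
                     (Vertices.#orbits*P≡∑P÷orbSize P (size∣P Vertices.orbSize>0 Vertices.orbSize≤n)) ⟨
      #F G * P + #V G * P
        ≡⟨ *-distribʳ-+ P (#F G) (#V G) ⟨
      (#F G + #V G) * P ∎)
      where
      open ≡-Reasoning
      P : ℕ
      P = (N + N) !
      P-nonZero : NonZero P
      P-nonZero = >-nonZero (1≤n! (N + N))
      size∣P : ∀ {s : Dart G → ℕ} → (∀ x → 0 < s x) → (∀ x → s x ≤ N) → ∀ x → s x ∣ P
      size∣P s>0 s≤N x = ∣n! (s>0 x) (≤-trans (s≤N x) (m≤m+n N N))

    eulerᴴ : #V H + #F H ≡ #E H + 2
    eulerᴴ = begin
      #V H + #F H                ≡⟨ cong₂ _+_ #Vᴴ≡#F+#V #Fᴴ≡#E ⟩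
      #F G + #V G + #E G         ≡⟨ cong (_+ #E G) (+-comm (#F G) (#V G)) ⟩
      #V G + #F G + #E G         ≡⟨ cong (_+ #E G) (proj₂ spherical) ⟩
      #E G + 2 + #E G            ≡⟨ rearrange (#E G) ⟩
      #E G * 2 + 2               ≡⟨ cong (_+ 2) (trans #E*2≡n (sym #Eᴴ≡n)) ⟩
      #E H + 2                   ∎
      where
      open ≡-Reasoning
      rearrange : ∀ e → e + 2 + e ≡ e * 2 + 2
      rearrange = solve-∀

    no-loopᴴ : ∀ d → ¬ SameVertex H d (α H d)
    no-loopᴴ d with view d
    ... | isL x = ¬SameVertex-LR ∘ subst (SameVertex H (L x)) (α-L x)
    ... | isR y = ¬SameVertex-RL ∘ subst (SameVertex H (R y)) (α-R y)

    simpleᴴ : Simple H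
    simpleᴴ = no-loopᴴ , one-edge
      where
      same-ends-and-face : ∀ {x x′} → SameFace G (α G x) (α G x′) → SameVertex G x x′ → x ≡ x′
      same-ends-and-face {x} {x′} αx~αx′ x≈x′ = Vertices.f^-injective 1 (face-disk-≡
        (Faces.Orb-trans (Faces.Orb-sym (σ-on-face-of-α x)) (Faces.Orb-trans αx~αx′ (σ-on-face-of-α x′)))
        (Vertices.Orb-trans (Vertices.Orb-sym (Vertices.Orb-f x)) (Vertices.Orb-trans x≈x′ (Vertices.Orb-f x′))))

      one-edge : ∀ d d′ → SameVertex H d d′ → SameVertex H (α H d) (α H d′) → d ≡ d′
      one-edge d d′ d≈d′ αd≈αd′ with view d | view d′
      ... | isL x | isL x′ = cong L (same-ends-and-face (Equivalence.to SameVertex-L⇔ d≈d′)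
            (Vertices.Orb-sym (Equivalence.to SameVertex-R⇔ (subst₂ (SameVertex H) (α-L x) (α-L x′) αd≈αd′))))
      ... | isL x | isR y′ = contradiction d≈d′ ¬SameVertex-LR
      ... | isR y | isL x′ = contradiction d≈d′ ¬SameVertex-RL
      ... | isR y | isR y′ = cong R (same-ends-and-face
            (Equivalence.to SameVertex-L⇔ (subst₂ (SameVertex H) (α-R y) (α-R y′) αd≈αd′))
            (Vertices.Orb-sym (Equivalence.to SameVertex-R⇔ d≈d′)))

    private
      σ-step′ : ∀ {d e d′} → σ H d ≡ e → Reach H e d′ → Reach H d d′
      σ-step′ refl = σ-step

      α-step′ : ∀ {d e d′} → α H d ≡ e → Reach H e d′ → Reach H d d′
      α-step′ refl = α-step

      L→Lσ : ∀ z → Reach H (L z) (L (σ G z))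
      L→Lσ z = σ-step′ (σ-L z) (α-step′ (α-L _) (σ-step′ (σ-R _) (α-step′ (α-R _)
                 (σ-step′ (trans (σ-L _) (cong L (trans (cong (α G) (σσ⁻ _)) (αα _)))) here))))

      L→Lα : ∀ x → Reach H (L x) (L (α G x))
      L→Lα x = α-step′ (α-L x) (σ-step′ (σ-R x) (α-step′ (α-R _)
                 (σ-step′ (trans (σ-L _) (cong (λ z → L (α G z)) (σσ⁻ x))) here)))

      lift : ∀ {x y} → Reach G x y → Reach H (L x) (L y)
      lift here         = here
      lift (σ-step x→y) = Reach-trans (L→Lσ _) (lift x→y)
      lift (α-step x→y) = Reach-trans (L→Lα _) (lift x→y)

      into-L : ∀ d → ∃[ x ] Reach H d (L x)
      into-L d with view d
      ... | isL x = x , here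
      ... | isR y = y , α-step′ (α-R y) here

      out-of-L : ∀ d → ∃[ x ] Reach H (L x) d
      out-of-L d with view d
      ... | isL x = x , here
      ... | isR y = y , α-step′ (α-L y) here

    connectedᴴ : Connected H
    connectedᴴ d d′ =
      let x , d→Lx  = into-L d
          y , Ly→d′ = out-of-L d′
      in  Reach-trans d→Lx (Reach-trans (lift (proj₁ spherical x y)) Ly→d′)

    sphericalᴴ : Spherical H
    sphericalᴴ = connectedᴴ , eulerᴴ

    private
      module TC = TwoConnectivity isMapᴴ no-loopᴴ

      module _ {v : Dart H} where
        avoid-σ : ∀ {d e d′} → σ H d ≡ e → ¬ SameVertex H v e → ReachAvoid H v e d′ → ReachAvoid H v d d′
        avoid-σ refl = σ-step

        avoid-α : ∀ {d e d′} → α H d ≡ e → ¬ SameVertex H v e → ReachAvoid H v e d′ → ReachAvoid H v d d′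
        avoid-α refl = α-step

      -- the detour passes through the face on the other side of the edge of σ z
      face-vertex-step : ∀ z₀ w → SameVertex H (L z₀) w → ReachAvoid H (L z₀) (α H w) (α H (σ H w))
      face-vertex-step z₀ w v≈w with view w
      ... | isR y = contradiction v≈w ¬SameVertex-LR
      ... | isL z = subst₂ (ReachAvoid H (L z₀)) (sym (α-L z)) (sym (trans (cong (α H) (σ-L z)) (α-L t)))
          (TC.ReachAvoid-trans v (TC.around-vertex v ¬SameVertex-LR
                                    (Equivalence.from SameVertex-R⇔ (Vertices.Orb-sym (Vertices.Orb-f z))))
          (avoid-α (α-R (σ G z)) v≉Lσz
          (TC.ReachAvoid-trans v (TC.around-vertex v v≉Lσz
                                    (Equivalence.from SameVertex-L⇔ (Faces.Orb-sym (1 , φ∘φ⁻ t))))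
          (avoid-α (α-L (σ⁻ G t)) ¬SameVertex-LR
          (TC.around-vertex v ¬SameVertex-LR
                            (Equivalence.from SameVertex-R⇔ (Vertices.Orb-sym (1 , σσ⁻ t))))))))
        where
        v = L z₀
        t = α G (σ G z)
        v≉Lσz : ¬ SameVertex H v (L (σ G z))
        v≉Lσz v≈Lσz = two-faces (σ G z) (Faces.Orb-trans (Faces.Orb-sym (σ-on-face-of-α z))
          (Equivalence.to SameVertex-L⇔ (Hᵒ.Vertices.Orb-trans (Hᵒ.Vertices.Orb-sym v≈w) v≈Lσz)))

      -- the detour passes through the other endpoint of the edge of z, which is not v as G has no loops
      vertex-vertex-step : ∀ y₀ w → SameVertex H (R y₀) w → ReachAvoid H (R y₀) (α H (σ H w)) (α H w)
      vertex-vertex-step y₀ w v≈w with view w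
      ... | isL x = contradiction v≈w ¬SameVertex-RL
      ... | isR z = subst₂ (ReachAvoid H (R y₀)) (sym (trans (cong (α H) (σ-R z)) (α-R _))) (sym (α-R z))
          (subst (λ u → ReachAvoid H (R y₀) (L z′) (L u)) (σσ⁻ z)
            (avoid-σ (σ-L z′) ¬SameVertex-RL
            (avoid-α (α-L t) v≉Rt
            (avoid-σ (σ-R t) v≉Rσ⁻t
            (avoid-α (α-R (σ⁻ G t)) ¬SameVertex-RL
            (avoid-σ (trans (σ-L _) (cong L (trans (cong (α G) (σσ⁻ t)) (αα (σ G z′))))) ¬SameVertex-RL here))))))
        where
        z′ = σ⁻ G z
        t = α G (σ G z′)
        v≉Rt : ¬ SameVertex H (R y₀) (R t)
        v≉Rt v≈Rt = no-loop (σ G z′) (Vertices.Orb-trans (subst (SameVertex G (σ G z′)) (σσ⁻ z) (Vertices.Orb-refl _))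
          (Equivalence.to SameVertex-R⇔ (Hᵒ.Vertices.Orb-trans (Hᵒ.Vertices.Orb-sym v≈Rt) v≈w)))
        v≉Rσ⁻t : ¬ SameVertex H (R y₀) (R (σ⁻ G t))
        v≉Rσ⁻t v≈ = v≉Rt (Hᵒ.Vertices.Orb-trans v≈ (Equivalence.from SameVertex-R⇔ (Vertices.Orb-sym (1 , σσ⁻ t))))

    twoConnectedᴴ : TwoConnected H
    twoConnectedᴴ = TC.twoConnected connectedᴴ link
      where
      link : ∀ v → TC.LinkConnected v
      link v with view v
      ... | isL z₀ = TC.linkConnected-forward (L z₀) (face-vertex-step z₀)
      ... | isR y₀ = TC.linkConnected-backward (R y₀) (vertex-vertex-step y₀)

    module _ (positive : ∀ e → 0ℤ ℤ.< RicF G e) where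

      private
        vdeg-σ⁻ : ∀ x → vdeg G (σ⁻ G x) ≡ vdeg G x
        vdeg-σ⁻ x = Vertices.orbSize-cong (1 , σσ⁻ x)

        corners-L : ∀ x → vdeg H (L x) + vdeg H (φ H (L x)) + vdeg H (φ H (φ H (L x))) + vdeg H (φ H (φ H (φ H (L x))))
                          ≡ degreeSum x
        corners-L x = trans
          (cong₂ _+_ (cong₂ _+_ (cong₂ _+_
            (vdeg-L x)
            (trans (cong (vdeg H) (φ-L x)) (trans (vdeg-R _) (vdeg-σ⁻ x))))
            (trans (cong (vdeg H) (φ²-L x)) (trans (vdeg-L _) (cong (fdeg G) (αα x)))))
            (trans (cong (vdeg H) (φ³-L x)) (trans (vdeg-R _) (vdeg-σ⁻ (α G x)))))
          (rearrange (fdeg G (α G x)) (vdeg G x) (fdeg G x) (vdeg G (α G x)))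
          where
          rearrange : ∀ p q r s → p + q + r + s ≡ q + s + r + p
          rearrange = solve-∀

        corners-R : ∀ y → vdeg H (R y) + vdeg H (φ H (R y)) + vdeg H (φ H (φ H (R y))) + vdeg H (φ H (φ H (φ H (R y))))
                          ≡ degreeSum (σ G y)
        corners-R y = trans
          (cong₂ _+_ (cong₂ _+_ (cong₂ _+_
            (trans (vdeg-R y) (Vertices.orbSize-cong (Vertices.Orb-f y)))
            (trans (cong (vdeg H) (φ-R y)) (trans (vdeg-L _) (cong (fdeg G) (αα (σ G y))))))
            (trans (cong (vdeg H) (trans (cong (φ H) (φ-R y)) (φ-L _))) (trans (vdeg-R _) (vdeg-σ⁻ _))))
            (trans (cong (vdeg H) (trans (cong (φ H) (cong (φ H) (φ-R y))) (φ²-L _)))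
                   (trans (vdeg-L _) (cong (fdeg G) (αα (α G (σ G y)))))))
          (rearrange (vdeg G (σ G y)) (fdeg G (σ G y)) (vdeg G (α G (σ G y))) (fdeg G (α G (σ G y))))
          where
          rearrange : ∀ p q r s → p + q + r + s ≡ p + r + q + s
          rearrange = solve-∀

        corner-sum≤15 : ∀ d → vdeg H d + vdeg H (φ H d) + vdeg H (φ H (φ H d)) + vdeg H (φ H (φ H (φ H d))) ≤ 15
        corner-sum≤15 d with view d
        ... | isL x = subst (_≤ 15) (sym (corners-L x)) (degreeSum≤15 positive x)
        ... | isR y = subst (_≤ 15) (sym (corners-R y)) (degreeSum≤15 positive (σ G y))

      patternsᴴ : ∀ d → facePattern H d ∈ allowedPatterns H
      patternsᴴ d = pattern-allowed H (vdeg≥3ᴴ d) (vdeg≥3ᴴ _) (vdeg≥3ᴴ _) (vdeg≥3ᴴ _) (corner-sum≤15 d)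

open import Data.Integer using (0ℤ; _<_)
open import Data.Nat using (_≤_)
open import Relation.Binary.PropositionalEquality using (subst; sym)

lemma3p2 : (G : Map) → Tessellation G → (∀ e → 0ℤ < RicF G e) →
           InQ (dual (medial G))
lemma3p2 G tess positive = record
  { isMap        = isMapᴴ
  ; spherical    = sphericalᴴ
  ; simple       = simpleᴴ
  ; twoConnected = twoConnectedᴴ
  ; quadrangular = quadrangularᴴ
  ; #F≤24        = subst (_≤ 24) (sym #Fᴴ≡#E) (#E≤24 positive)
  ; patterns     = patternsᴴ positive
  }
  where
  open MedialDual tess
  open OfTessellation tess using (#E≤24)
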